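{- Let $X$ be a finite set, let $d,r$ be positive integers, and let $\beta,\alpha>0$. Then there exists $C = C(X,d,r,\beta,\alpha)$ such that for every positive integer $n$ and any subsets $E_1,\dots,E_d$ of $X^n$ there exists $I \subset [n]$ with $0<|I|<C$ which simultaneously satisfies \[ \mathbb{P}_{y \in X^I} ((E_j)_{I \to y} \text{ is not } (r,\beta) \text{ -pseudorandom}) \le \alpha \quad \text{ for every } j \in [d], \] where $y$ is chosen uniformly at random from $X^I$.
   Context: For a finite set $X$, an index set $J$ and $E\subset X^J$, the density of $E$ is $d(E)=|E|/|X^J|$. For $I\subset J$ and $y\in X^I$, $E_{I\to y}$ is the set of $x\in E$ with $x_i=y_i$ for all $i\in I$, regarded as a subset of $X^{J\setminus I}$, so its density is $|E_{I\to y}|/|X^{J\setminus I}|$. A subset $E$ of $X^{J}$ is $(r,\beta)$-pseudorandom if for every $I\subset J$ with $|I|\le r$ and every $y\in X^I$ we have $|d(E_{I\to y})-d(E)|\le\beta$.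
   Formalization: The parameters β and α range over the positive rationals. -}

module Defs where

open import Data.Bool using (Bool; true; false; not; _∨_; _∧_)
open import Data.Nat using (ℕ; zero; suc; _^_; NonZero)
open import Data.Nat.Properties using (m^n≢0)
open import Data.Fin using (Fin)
open import Data.Vec using (Vec; []; _∷_)
open import Data.List using (List; []; _∷_; map; concatMap; allFin)
open import Data.Integer using (+_)
open import Data.Rational using (ℚ; _/_; _-_; ∣_∣; _≤_)
open import Data.Rational.Properties using (_≤?_)
open import Relation.Nullary using (does)

-- The finite set X is modelled as Fin k (k = |X|, nonzero so densities are defined).
-- A point of X^m is a vector Vec (Fin k) m; a subset E ⊆ X^m is a Bool-valued predicate.
-- An index set I ⊆ [m] is a Vec Bool m (true = i ∈ I).

vecsOver : ∀ {A : Set} → List A → ∀ n → List (Vec A n)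
vecsOver xs zero    = [] ∷ []
vecsOver xs (suc n) = concatMap (λ x → map (x ∷_) (vecsOver xs n)) xs

allVecs : ∀ k n → List (Vec (Fin k) n)
allVecs k n = vecsOver (allFin k) n

allSubsets : ∀ m → List (Vec Bool m)
allSubsets m = vecsOver (true ∷ false ∷ []) m

allᵇ : ∀ {A : Set} → (A → Bool) → List A → Bool
allᵇ P []       = true
allᵇ P (x ∷ xs) = P x ∧ allᵇ P xs

countᵇ : ∀ {A : Set} → (A → Bool) → List A → ℕ
countᵇ P []       = 0
countᵇ P (x ∷ xs) with P x
... | true  = suc (countᵇ P xs)
... | false = countᵇ P xs

inCount : ∀ {m} → Vec Bool m → ℕ
inCount []          = 0
inCount (true ∷ I)  = suc (inCount I)
inCount (false ∷ I) = inCount I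

outCount : ∀ {m} → Vec Bool m → ℕ
outCount []          = 0
outCount (true ∷ I)  = outCount I
outCount (false ∷ I) = suc (outCount I)

merge : ∀ {A : Set} {m} (I : Vec Bool m) → Vec A (inCount I) → Vec A (outCount I) → Vec A m
merge []          []       []       = []
merge (true ∷ I)  (y ∷ ys) zs       = y ∷ merge I ys zs
merge (false ∷ I) ys       (z ∷ zs) = z ∷ merge I ys zs

density : ∀ k .{{_ : NonZero k}} m → (Vec (Fin k) m → Bool) → ℚ
density k m E = (+ countᵇ E (allVecs k m)) / (k ^ m)
  where instance _ = m^n≢0 k m

restrict : ∀ {k m} → (Vec (Fin k) m → Bool) → (I : Vec Bool m) → Vec (Fin k) (inCount I)
         → (Vec (Fin k) (outCount I) → Bool)
restrict E I y z = E (merge I y z)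

Pseudorandom : ∀ k .{{_ : NonZero k}} m → ℕ → ℚ → (Vec (Fin k) m → Bool) → Set
Pseudorandom k m r β E =
  ∀ (I : Vec Bool m) → inCount I Data.Nat.≤ r → ∀ (y : Vec (Fin k) (inCount I)) →
    ∣ density k (outCount I) (restrict E I y) - density k m E ∣ ≤ β

-- the same property, decided by exhaustive check over all I and y (needed for counting)
pseudorandomᵇ : ∀ k .{{_ : NonZero k}} m → ℕ → ℚ → (Vec (Fin k) m → Bool) → Bool
pseudorandomᵇ k m r β E =
  allᵇ (λ I → not (inCount I Data.Nat.≤ᵇ r) ∨
             allᵇ (λ y → does (∣ density k (outCount I) (restrict E I y) - density k m E ∣ ≤? β))
                 (allVecs k (inCount I)))
      (allSubsets m)

probNotPR : ∀ k .{{_ : NonZero k}} {n} → ℕ → ℚ → (Vec (Fin k) n → Bool) → Vec Bool n → ℚ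
probNotPR k r β E I =
  density k (inCount I) (λ y → not (pseudorandomᵇ k (outCount I) r β (restrict E I y)))

module Submission where

-- For a set I of coordinates, averaging 1_E over the fibres of x ↦ x|_I gives
-- the densities D_I(x) = d(E_{I→x|_I}); the energy ∑ₓ D_I(x)² never exceeds |X^n| and only grows
-- when I is enlarged, the growth being ∑ₓ (D_K(x) − D_I(x))² for I ⊆ K (Pythagoras for nested
-- partitions). If more than a proportion α of the fibres E_{I→y} are not (r, β)-pseudorandom, add
-- to I, for every y, a set J_y of at most r coordinates on which E_{I→y} deviates by more than β.
-- The new set has at most |I| + |X|^|I| r elements, and the energy grows by at least
-- α β² |X|^(−r) |X^n|. Summing the energies of E_1, …, E_d, fewer than d |X|^r / (α β²) + 1 such
-- steps are possible starting from one coordinate, which bounds |I| independently of n.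

open import Data.Bool using (Bool; true; false; not; _∧_; _∨_; if_then_else_; T)
open import Data.Bool.Properties using (∧-conicalˡ; ∧-conicalʳ)
open import Data.Empty using (⊥-elim)
open import Data.Sum using (inj₁; inj₂)
open import Data.Fin as F using (Fin; zero; suc)
open import Data.Fin.Properties using (all?; ¬∀⟶∃¬)
open import Data.Integer as ℤ using (ℤ)
import Data.Integer.Properties as ℤ
open import Data.Integer.Solver renaming (module +-*-Solver to ℤ-Solver)
open import Data.List using (List; []; _∷_; _++_; map; concatMap; length; allFin)
open import Data.List.Membership.Propositional using (_∈_; lose)
open import Data.List.Membership.Propositional.Properties using (∈-map⁺; ∈-concatMap⁺; ∈-allFin)
open import Data.List.Properties using (map-tabulate; length-tabulate)
open import Data.List.Relation.Unary.Any using (here; there)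
open import Data.Maybe using (Maybe; just; nothing; fromMaybe)
open import Data.Nat as ℕ using (ℕ; zero; suc; _^_; NonZero; z≤n; s≤s)
open import Data.Nat.GeneralisedArithmetic using (iterate)
import Data.Nat.Properties as ℕ
open import Data.Product using (Σ; ∃; _×_; _,_; proj₁; proj₂)
open import Data.Rational as ℚ
  using (ℚ; 0ℚ; 1ℚ; _+_; _*_; _-_; -_; _/_; ∣_∣; _≤_; _<_; toℚᵘ; mkℚ; *≤*)
open import Data.Rational.Properties
open import Data.Rational.Solver using (module +-*-Solver)
import Data.Rational.Unnormalised as ℚᵘ
import Data.Rational.Unnormalised.Properties as ℚᵘ
open import Data.Unit using (tt)
open import Data.Vec using (Vec; []; _∷_; replicate)
open import Data.Vec.Properties using (∷-injectiveˡ; ∷-injectiveʳ; ≡-dec)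
open import Function using (id; _∘_)
open import Relation.Binary.PropositionalEquality hiding (J)
open import Relation.Nullary using (Dec; yes; no; ¬_; does)
open import Relation.Nullary.Decidable using (dec-true)

open import Defs

fromℕ : ℕ → ℚ
fromℕ n = ℤ.+ n / 1

1/ℕ : ℕ → ℚ
1/ℕ zero    = 0ℚ
1/ℕ (suc m) = ℤ.+ 1 / suc m

toℚᵘ-/ : ∀ i m → toℚᵘ (i / suc m) ℚᵘ.≃ ℚᵘ.mkℚᵘ i m
toℚᵘ-/ i m = lemma (i / suc m) (↥-/ i (suc m)) (↧-/ i (suc m))
  where
  open ℤ-Solver
  lemma : ∀ p {g} → ℚ.↥ p ℤ.* g ≡ i → ℚ.↧ p ℤ.* g ≡ ℤ.+ suc m → toℚᵘ p ℚᵘ.≃ ℚᵘ.mkℚᵘ i m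
  lemma (mkℚ a b-1 _) {g} a*g≡i b*g≡m+1 = ℚᵘ.*≡* (begin
    a ℤ.* ℤ.+ suc m  ≡⟨ cong (a ℤ.*_) (sym b*g≡m+1) ⟩
    a ℤ.* (b ℤ.* g)  ≡⟨ solve 3 (λ a b g → a :* (b :* g) := (a :* g) :* b) refl a b g ⟩
    (a ℤ.* g) ℤ.* b  ≡⟨ cong (ℤ._* b) a*g≡i ⟩
    i ℤ.* b          ∎)
    where
    open ≡-Reasoning
    b = ℤ.+ suc b-1

toℚᵘ-fromℕ : ∀ n → toℚᵘ (fromℕ n) ℚᵘ.≃ ℚᵘ.mkℚᵘ (ℤ.+ n) 0
toℚᵘ-fromℕ n = toℚᵘ-/ (ℤ.+ n) 0

fromℕ-unique : ∀ {p} n → toℚᵘ p ℚᵘ.≃ ℚᵘ.mkℚᵘ (ℤ.+ n) 0 → fromℕ n ≡ p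
fromℕ-unique n p≃n = toℚᵘ-injective (ℚᵘ.≃-trans (toℚᵘ-fromℕ n) (ℚᵘ.≃-sym p≃n))

fromℕ-+ : ∀ a b → fromℕ (a ℕ.+ b) ≡ fromℕ a + fromℕ b
fromℕ-+ a b = fromℕ-unique (a ℕ.+ b) (begin
  toℚᵘ (fromℕ a + fromℕ b)                  ≈⟨ toℚᵘ-homo-+ (fromℕ a) (fromℕ b) ⟩
  toℚᵘ (fromℕ a) ℚᵘ.+ toℚᵘ (fromℕ b)        ≈⟨ ℚᵘ.+-cong (toℚᵘ-fromℕ a) (toℚᵘ-fromℕ b) ⟩
  ℚᵘ.mkℚᵘ (ℤ.+ a) 0 ℚᵘ.+ ℚᵘ.mkℚᵘ (ℤ.+ b) 0  ≈⟨ ℚᵘ.*≡* (cong (ℤ._* ℤ.+ 1) (cong₂ ℤ._+_ (ℤ.*-identityʳ (ℤ.+ a)) (ℤ.*-identityʳ (ℤ.+ b)))) ⟩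
  ℚᵘ.mkℚᵘ (ℤ.+ a ℤ.+ ℤ.+ b) 0               ≡⟨ cong (λ i → ℚᵘ.mkℚᵘ i 0) (sym (ℤ.pos-+ a b)) ⟩
  ℚᵘ.mkℚᵘ (ℤ.+ (a ℕ.+ b)) 0                 ∎)
  where open ℚᵘ.≃-Reasoning

fromℕ-* : ∀ a b → fromℕ (a ℕ.* b) ≡ fromℕ a * fromℕ b
fromℕ-* a b = fromℕ-unique (a ℕ.* b) (begin
  toℚᵘ (fromℕ a * fromℕ b)            ≈⟨ toℚᵘ-homo-* (fromℕ a) (fromℕ b) ⟩
  toℚᵘ (fromℕ a) ℚᵘ.* toℚᵘ (fromℕ b)  ≈⟨ ℚᵘ.*-cong (toℚᵘ-fromℕ a) (toℚᵘ-fromℕ b) ⟩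
  ℚᵘ.mkℚᵘ (ℤ.+ a ℤ.* ℤ.+ b) 0         ≡⟨ cong (λ i → ℚᵘ.mkℚᵘ i 0) (sym (ℤ.pos-* a b)) ⟩
  ℚᵘ.mkℚᵘ (ℤ.+ (a ℕ.* b)) 0           ∎)
  where open ℚᵘ.≃-Reasoning

fromℕ-mono-≤ : ∀ {a b} → a ℕ.≤ b → fromℕ a ≤ fromℕ b
fromℕ-mono-≤ {a} {b} a≤b = toℚᵘ-cancel-≤ (ℚᵘ.≤-respˡ-≃ (ℚᵘ.≃-sym (toℚᵘ-fromℕ a))
  (ℚᵘ.≤-respʳ-≃ (ℚᵘ.≃-sym (toℚᵘ-fromℕ b)) (ℚᵘ.*≤* (ℤ.*-monoʳ-≤-nonNeg (ℤ.+ 1) (ℤ.+≤+ a≤b)))))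

fromℕ-injective : ∀ {a b} → fromℕ a ≡ fromℕ b → a ≡ b
fromℕ-injective {a} {b} eq with ℚᵘ.≃-trans (ℚᵘ.≃-sym (toℚᵘ-fromℕ a)) (ℚᵘ.≃-trans (ℚᵘ.≃-reflexive (cong toℚᵘ eq)) (toℚᵘ-fromℕ b))
... | ℚᵘ.*≡* a≡b = ℤ.+-injective (trans (sym (ℤ.*-identityʳ (ℤ.+ a))) (trans a≡b (ℤ.*-identityʳ (ℤ.+ b))))

fromℕ-mono-< : ∀ {a b} → a ℕ.< b → fromℕ a < fromℕ b
fromℕ-mono-< {a} {b} a<b = toℚᵘ-cancel-< (ℚᵘ.<-respˡ-≃ (ℚᵘ.≃-sym (toℚᵘ-fromℕ a))
  (ℚᵘ.<-respʳ-≃ (ℚᵘ.≃-sym (toℚᵘ-fromℕ b)) (ℚᵘ.*<* (ℤ.*-monoʳ-<-pos (ℤ.+ 1) (ℤ.+<+ a<b)))))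

fromℕ-nonNeg : ∀ n → 0ℚ ≤ fromℕ n
fromℕ-nonNeg n = fromℕ-mono-≤ {0} {n} z≤n

1/ℕ-nonNeg : ∀ n → 0ℚ ≤ 1/ℕ n
1/ℕ-nonNeg zero    = ≤-refl
1/ℕ-nonNeg (suc m) = nonNegative⁻¹ (ℤ.+ 1 / suc m) {{normalize-nonNeg 1 (suc m)}}

fromℕ-pos : ∀ n .{{_ : NonZero n}} → ℚ.Positive (fromℕ n)
fromℕ-pos (suc m) = normalize-pos (suc m) 1

1/ℕ-pos : ∀ n .{{_ : NonZero n}} → ℚ.Positive (1/ℕ n)
1/ℕ-pos (suc m) = normalize-pos 1 (suc m)

fromℕ*1/ℕ : ∀ n .{{_ : NonZero n}} → fromℕ n * 1/ℕ n ≡ 1ℚ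
fromℕ*1/ℕ (suc m) = toℚᵘ-injective (begin
  toℚᵘ (fromℕ (suc m) * 1/ℕ (suc m))              ≈⟨ toℚᵘ-homo-* (fromℕ (suc m)) (1/ℕ (suc m)) ⟩
  toℚᵘ (fromℕ (suc m)) ℚᵘ.* toℚᵘ (ℤ.+ 1 / suc m)  ≈⟨ ℚᵘ.*-cong (toℚᵘ-fromℕ (suc m)) (toℚᵘ-/ (ℤ.+ 1) m) ⟩
  ℚᵘ.mkℚᵘ (ℤ.+ suc m) 0 ℚᵘ.* ℚᵘ.mkℚᵘ (ℤ.+ 1) m    ≈⟨ ℚᵘ.*≡* m+1≡1*[m+1] ⟩
  toℚᵘ 1ℚ                                         ∎)
  where
  open ℚᵘ.≃-Reasoning
  m+1≡1*[m+1] : (ℤ.+ suc m ℤ.* ℤ.+ 1) ℤ.* ℤ.+ 1 ≡ ℤ.+ 1 ℤ.* ℤ.+ (1 ℕ.* suc m)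
  m+1≡1*[m+1] = trans (ℤ.*-identityʳ _) (trans (ℤ.*-identityʳ _)
    (trans (cong ℤ.+_ (sym (ℕ.*-identityˡ (suc m)))) (sym (ℤ.*-identityˡ _))))

/≡fromℕ*1/ℕ : ∀ a d .{{_ : NonZero d}} → ℤ.+ a / d ≡ fromℕ a * 1/ℕ d
/≡fromℕ*1/ℕ a (suc m) = toℚᵘ-injective (begin
  toℚᵘ (ℤ.+ a / suc m)                      ≈⟨ toℚᵘ-/ (ℤ.+ a) m ⟩
  ℚᵘ.mkℚᵘ (ℤ.+ a) m                         ≈⟨ ℚᵘ.*≡* (cong₂ ℤ._*_ (sym (ℤ.*-identityʳ (ℤ.+ a))) (cong ℤ.+_ (ℕ.*-identityˡ (suc m)))) ⟩
  ℚᵘ.mkℚᵘ (ℤ.+ a) 0 ℚᵘ.* ℚᵘ.mkℚᵘ (ℤ.+ 1) m  ≈⟨ ℚᵘ.≃-sym (ℚᵘ.*-cong (toℚᵘ-fromℕ a) (toℚᵘ-/ (ℤ.+ 1) m)) ⟩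
  toℚᵘ (fromℕ a) ℚᵘ.* toℚᵘ (1/ℕ (suc m))    ≈⟨ ℚᵘ.≃-sym (toℚᵘ-homo-* (fromℕ a) (1/ℕ (suc m))) ⟩
  toℚᵘ (fromℕ a * 1/ℕ (suc m))              ∎)
  where open ℚᵘ.≃-Reasoning

*-monoʳ-≤-0≤ : ∀ {p q r} → 0ℚ ≤ r → p ≤ q → p * r ≤ q * r
*-monoʳ-≤-0≤ {r = r} 0≤r = *-monoʳ-≤-nonNeg r {{ℚ.nonNegative 0≤r}}

*-monoˡ-≤-0≤ : ∀ {p q r} → 0ℚ ≤ r → p ≤ q → r * p ≤ r * q
*-monoˡ-≤-0≤ {r = r} 0≤r = *-monoˡ-≤-nonNeg r {{ℚ.nonNegative 0≤r}}

0≤* : ∀ {p q} → 0ℚ ≤ p → 0ℚ ≤ q → 0ℚ ≤ p * q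
0≤* {p} {q} 0≤p 0≤q = nonNegative⁻¹ (p * q) {{nonNeg*nonNeg⇒nonNeg p {{ℚ.nonNegative 0≤p}} q {{ℚ.nonNegative 0≤q}}}}

0≤p*p : ∀ p → 0ℚ ≤ p * p
0≤p*p p with ≤-total 0ℚ p
... | inj₁ 0≤p = 0≤* 0≤p 0≤p
... | inj₂ p≤0 = subst (0ℚ ≤_) (neg-*-neg p) (0≤* (neg-antimono-≤ p≤0) (neg-antimono-≤ p≤0))
  where
  open +-*-Solver
  neg-*-neg : ∀ p → - p * - p ≡ p * p
  neg-*-neg = solve 1 (λ p → (:- p) :* (:- p) := p :* p) refl

p*p≤1 : ∀ {p} → 0ℚ ≤ p → p ≤ 1ℚ → p * p ≤ 1ℚ
p*p≤1 {p} 0≤p p≤1 = ≤-trans (*-monoʳ-≤-0≤ 0≤p p≤1) (≤-trans (≤-reflexive (*-identityˡ p)) p≤1)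

0≤p<∣q∣⇒p*p≤q*q : ∀ {p q} → 0ℚ ≤ p → p < ∣ q ∣ → p * p ≤ q * q
0≤p<∣q∣⇒p*p≤q*q {p} {q} 0≤p p<∣q∣ = begin
  p * p          ≤⟨ *-monoʳ-≤-0≤ 0≤p (<⇒≤ p<∣q∣) ⟩
  ∣ q ∣ * p      ≤⟨ *-monoˡ-≤-0≤ (≤-trans 0≤p (<⇒≤ p<∣q∣)) (<⇒≤ p<∣q∣) ⟩
  ∣ q ∣ * ∣ q ∣  ≡⟨ sym (∣p*q∣≡∣p∣*∣q∣ q q) ⟩
  ∣ q * q ∣      ≡⟨ 0≤p⇒∣p∣≡p (0≤p*p q) ⟩
  q * q          ∎
  where open ≤-Reasoning

archimedean : ∀ q → 0ℚ < q → ∀ B → ∃ λ M → fromℕ B < fromℕ M * q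
archimedean (mkℚ (ℤ.+ zero) _ _) 0<q B with ℚ.positive 0<q
... | ()
archimedean (mkℚ ℤ.-[1+ _ ] _ _) 0<q B with ℚ.positive 0<q
... | ()
archimedean q@(mkℚ (ℤ.+ suc p) d-1 _) 0<q B = suc B ℕ.* suc d-1 , (begin-strict
  fromℕ B                        <⟨ fromℕ-mono-< (ℕ.n<1+n B) ⟩
  fromℕ (suc B)                  ≡⟨ sym (*-identityʳ _) ⟩
  fromℕ (suc B) * 1ℚ             ≤⟨ *-monoˡ-≤-0≤ (fromℕ-nonNeg (suc B)) (fromℕ-mono-≤ (s≤s (z≤n {p}))) ⟩
  fromℕ (suc B) * fromℕ (suc p)  ≡⟨ sym M*q≡ ⟩
  fromℕ (suc B ℕ.* suc d-1) * q  ∎)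
  where
  open ≤-Reasoning
  open +-*-Solver
  D = suc d-1
  M*q≡ : fromℕ (suc B ℕ.* D) * q ≡ fromℕ (suc B) * fromℕ (suc p)
  M*q≡ = begin-equality
    fromℕ (suc B ℕ.* D) * q                            ≡⟨ cong₂ _*_ (fromℕ-* (suc B) D) (trans (sym (↥p/↧p≡p q)) (/≡fromℕ*1/ℕ (suc p) D)) ⟩
    fromℕ (suc B) * fromℕ D * (fromℕ (suc p) * 1/ℕ D)  ≡⟨ solve 4 (λ b d p i → b :* d :* (p :* i) := b :* p :* (d :* i)) refl (fromℕ (suc B)) (fromℕ D) (fromℕ (suc p)) (1/ℕ D) ⟩
    fromℕ (suc B) * fromℕ (suc p) * (fromℕ D * 1/ℕ D)  ≡⟨ cong (fromℕ (suc B) * fromℕ (suc p) *_) (fromℕ*1/ℕ D) ⟩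
    fromℕ (suc B) * fromℕ (suc p) * 1ℚ                 ≡⟨ *-identityʳ _ ⟩
    fromℕ (suc B) * fromℕ (suc p)                      ∎

∑ : ∀ {A : Set} → (A → ℚ) → List A → ℚ
∑ f []       = 0ℚ
∑ f (x ∷ xs) = f x + ∑ f xs

𝟙 : Bool → ℚ
𝟙 true  = 1ℚ
𝟙 false = 0ℚ

𝟙-nonNeg : ∀ b → 0ℚ ≤ 𝟙 b
𝟙-nonNeg true  = *≤* (ℤ.+≤+ z≤n)
𝟙-nonNeg false = ≤-refl

𝟙≤1 : ∀ b → 𝟙 b ≤ 1ℚ
𝟙≤1 true  = ≤-refl
𝟙≤1 false = *≤* (ℤ.+≤+ z≤n)

𝟙-∧ : ∀ a b → 𝟙 (a ∧ b) ≡ 𝟙 a * 𝟙 b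
𝟙-∧ true  b = sym (*-identityˡ (𝟙 b))
𝟙-∧ false b = sym (*-zeroˡ (𝟙 b))

module _ {A : Set} where

  ∑-cong-∈ : ∀ {f g : A → ℚ} xs → (∀ x → x ∈ xs → f x ≡ g x) → ∑ f xs ≡ ∑ g xs
  ∑-cong-∈ []       f≡g = refl
  ∑-cong-∈ (x ∷ xs) f≡g = cong₂ _+_ (f≡g x (here refl)) (∑-cong-∈ xs (λ y y∈xs → f≡g y (there y∈xs)))

  ∑-cong : ∀ {f g : A → ℚ} xs → (∀ x → f x ≡ g x) → ∑ f xs ≡ ∑ g xs
  ∑-cong xs f≡g = ∑-cong-∈ xs (λ x _ → f≡g x)

  ∑-++ : ∀ (f : A → ℚ) xs ys → ∑ f (xs ++ ys) ≡ ∑ f xs + ∑ f ys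
  ∑-++ f []       ys = sym (+-identityˡ _)
  ∑-++ f (x ∷ xs) ys = trans (cong (f x +_) (∑-++ f xs ys)) (sym (+-assoc (f x) _ _))

  ∑-0 : ∀ xs → ∑ (λ (_ : A) → 0ℚ) xs ≡ 0ℚ
  ∑-0 []       = refl
  ∑-0 (x ∷ xs) = trans (+-identityˡ _) (∑-0 xs)

  ∑-+ : ∀ (f g : A → ℚ) xs → ∑ (λ x → f x + g x) xs ≡ ∑ f xs + ∑ g xs
  ∑-+ f g []       = sym (+-identityˡ 0ℚ)
  ∑-+ f g (x ∷ xs) = trans (cong (f x + g x +_) (∑-+ f g xs)) (interchange (f x) (g x) (∑ f xs) (∑ g xs))
    where
    open +-*-Solver
    interchange : ∀ a b c d → a + b + (c + d) ≡ a + c + (b + d)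
    interchange = solve 4 (λ a b c d → a :+ b :+ (c :+ d) := a :+ c :+ (b :+ d)) refl

  ∑-neg : ∀ (f : A → ℚ) xs → ∑ (λ x → - f x) xs ≡ - ∑ f xs
  ∑-neg f []       = refl
  ∑-neg f (x ∷ xs) = trans (cong (- f x +_) (∑-neg f xs)) (sym (neg-distrib-+ (f x) (∑ f xs)))

  ∑-- : ∀ (f g : A → ℚ) xs → ∑ (λ x → f x - g x) xs ≡ ∑ f xs - ∑ g xs
  ∑-- f g xs = trans (∑-+ f (λ x → - g x) xs) (cong (∑ f xs +_) (∑-neg g xs))

  ∑-*ˡ : ∀ c (f : A → ℚ) xs → ∑ (λ x → c * f x) xs ≡ c * ∑ f xs
  ∑-*ˡ c f []       = sym (*-zeroʳ c)
  ∑-*ˡ c f (x ∷ xs) = trans (cong (c * f x +_) (∑-*ˡ c f xs)) (sym (*-distribˡ-+ c (f x) (∑ f xs)))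

  ∑-*ʳ : ∀ c (f : A → ℚ) xs → ∑ (λ x → f x * c) xs ≡ ∑ f xs * c
  ∑-*ʳ c f xs = trans (∑-cong xs (λ x → *-comm (f x) c)) (trans (∑-*ˡ c f xs) (*-comm c _))

  ∑-mono-≤ : ∀ {f g : A → ℚ} xs → (∀ x → x ∈ xs → f x ≤ g x) → ∑ f xs ≤ ∑ g xs
  ∑-mono-≤ []       f≤g = ≤-refl
  ∑-mono-≤ (x ∷ xs) f≤g = +-mono-≤ (f≤g x (here refl)) (∑-mono-≤ xs (λ y y∈xs → f≤g y (there y∈xs)))

  ∑-nonNeg : ∀ {f : A → ℚ} xs → (∀ x → x ∈ xs → 0ℚ ≤ f x) → 0ℚ ≤ ∑ f xs
  ∑-nonNeg xs 0≤f = ≤-trans (≤-reflexive (sym (∑-0 xs))) (∑-mono-≤ xs 0≤f)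

  term≤∑ : ∀ {f : A → ℚ} xs {y} → y ∈ xs → (∀ x → x ∈ xs → 0ℚ ≤ f x) → f y ≤ ∑ f xs
  term≤∑ {f} (x ∷ xs) (here refl) 0≤f =
    ≤-trans (≤-reflexive (sym (+-identityʳ (f x)))) (+-monoʳ-≤ (f x) (∑-nonNeg xs (λ z z∈xs → 0≤f z (there z∈xs))))
  term≤∑ {f} (x ∷ xs) (there y∈xs) 0≤f =
    ≤-trans (term≤∑ xs y∈xs (λ z z∈xs → 0≤f z (there z∈xs)))
            (≤-trans (≤-reflexive (sym (+-identityˡ (∑ f xs)))) (+-monoˡ-≤ (∑ f xs) (0≤f x (here refl))))

  ∑-𝟙 : ∀ (P : A → Bool) xs → ∑ (λ x → 𝟙 (P x)) xs ≡ fromℕ (countᵇ P xs)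
  ∑-𝟙 P []       = refl
  ∑-𝟙 P (x ∷ xs) with P x
  ... | true  = trans (cong (1ℚ +_) (∑-𝟙 P xs)) (sym (fromℕ-+ 1 (countᵇ P xs)))
  ... | false = trans (+-identityˡ _) (∑-𝟙 P xs)

  ∑-1 : ∀ (xs : List A) → ∑ (λ _ → 1ℚ) xs ≡ fromℕ (length xs)
  ∑-1 []       = refl
  ∑-1 (x ∷ xs) = trans (cong (1ℚ +_) (∑-1 xs)) (sym (fromℕ-+ 1 (length xs)))

  ∑-const : ∀ c (xs : List A) → ∑ (λ _ → c) xs ≡ fromℕ (length xs) * c
  ∑-const c xs = trans (∑-cong xs (λ _ → sym (*-identityˡ c))) (trans (∑-*ʳ c (λ _ → 1ℚ) xs) (cong (_* c) (∑-1 xs)))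

∑-mono-≤-gain : ∀ {A : Set} {f g : A → ℚ} {δ} xs {x₀} → x₀ ∈ xs → (∀ x → f x ≤ g x) → f x₀ + δ ≤ g x₀ →
                ∑ f xs + δ ≤ ∑ g xs
∑-mono-≤-gain {f = f} {g} {δ} (x ∷ xs) (here refl) f≤g gain = begin
  f x + ∑ f xs + δ  ≡⟨ solve 3 (λ a b c → a :+ b :+ c := a :+ c :+ b) refl (f x) (∑ f xs) δ ⟩
  f x + δ + ∑ f xs  ≤⟨ +-mono-≤ gain (∑-mono-≤ xs (λ y _ → f≤g y)) ⟩
  g x + ∑ g xs      ∎
  where
  open ≤-Reasoning
  open +-*-Solver
∑-mono-≤-gain {f = f} {g} {δ} (x ∷ xs) (there x₀∈xs) f≤g gain = begin
  f x + ∑ f xs + δ    ≡⟨ +-assoc (f x) (∑ f xs) δ ⟩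
  f x + (∑ f xs + δ)  ≤⟨ +-mono-≤ (f≤g x) (∑-mono-≤-gain xs x₀∈xs f≤g gain) ⟩
  g x + ∑ g xs        ∎
  where open ≤-Reasoning

module _ {A B : Set} where

  ∑-map : ∀ (f : B → ℚ) (h : A → B) xs → ∑ f (map h xs) ≡ ∑ (f ∘ h) xs
  ∑-map f h []       = refl
  ∑-map f h (x ∷ xs) = cong (f (h x) +_) (∑-map f h xs)

  ∑-concatMap : ∀ (f : B → ℚ) (g : A → List B) xs → ∑ f (concatMap g xs) ≡ ∑ (λ x → ∑ f (g x)) xs
  ∑-concatMap f g []       = refl
  ∑-concatMap f g (x ∷ xs) = trans (∑-++ f (g x) (concatMap g xs)) (cong (∑ f (g x) +_) (∑-concatMap f g xs))

  ∑-comm : ∀ (f : A → B → ℚ) xs ys → ∑ (λ x → ∑ (f x) ys) xs ≡ ∑ (λ y → ∑ (λ x → f x y) xs) ys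
  ∑-comm f []       ys = sym (∑-0 ys)
  ∑-comm f (x ∷ xs) ys = trans (cong (∑ (f x) ys +_) (∑-comm f xs ys)) (sym (∑-+ (f x) (λ y → ∑ (λ x′ → f x′ y) xs) ys))

module _ {A : Set} where

  countᵇ-cong : ∀ {P Q : A → Bool} xs → (∀ x → P x ≡ Q x) → countᵇ P xs ≡ countᵇ Q xs
  countᵇ-cong {P} {Q} []       P≡Q = refl
  countᵇ-cong {P} {Q} (x ∷ xs) P≡Q with P x | Q x | P≡Q x
  ... | true  | .true  | refl = cong suc (countᵇ-cong xs P≡Q)
  ... | false | .false | refl = countᵇ-cong xs P≡Q

  countᵇ-nonZero : ∀ (P : A → Bool) xs {x} → x ∈ xs → P x ≡ true → NonZero (countᵇ P xs)
  countᵇ-nonZero P (y ∷ xs) (here refl) Py with P y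
  ... | true = _
  countᵇ-nonZero P (y ∷ xs) (there x∈xs) Px with P y
  ... | true  = _
  ... | false = countᵇ-nonZero P xs x∈xs Px

-- Conditional expectation with respect to a partition

record IsEquivalenceᵇ {A : Set} (s : A → A → Bool) : Set where
  field
    reflᵇ  : ∀ x → s x x ≡ true
    symᵇ   : ∀ x y → s x y ≡ true → s y x ≡ true
    transᵇ : ∀ x y z → s x y ≡ true → s y z ≡ true → s x z ≡ true

  same-class : ∀ x w → s x w ≡ true → ∀ v → s x v ≡ s w v
  same-class x w xw v with s x v in xv | s w v in wv
  ... | true  | true  = refl
  ... | false | false = refl
  ... | true  | false = trans (sym (transᵇ w x v (symᵇ x w xw) xv)) wv
  ... | false | true  = trans (sym xv) (transᵇ x w v xw wv)

  symᵇ-false : ∀ x y → s x y ≡ false → s y x ≡ false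
  symᵇ-false x y xy with s y x in yx
  ... | false = refl
  ... | true  = trans (sym (symᵇ y x yx)) xy

  symmetricᵇ : ∀ x y → s x y ≡ s y x
  symmetricᵇ x y with s x y in xy
  ... | true  = sym (symᵇ x y xy)
  ... | false = sym (symᵇ-false x y xy)

open IsEquivalenceᵇ

_Refines_ : ∀ {A : Set} → (A → A → Bool) → (A → A → Bool) → Set
t Refines s = ∀ x w → t x w ≡ true → s x w ≡ true

module ConditionalExpectation {A : Set} (Ω : List A) where

  classSize : (A → A → Bool) → A → ℕ
  classSize s x = countᵇ (s x) Ω

  𝔼[_∣_] : (A → ℚ) → (A → A → Bool) → A → ℚ
  𝔼[ g ∣ s ] x = ∑ (λ w → 𝟙 (s x w) * g w) Ω * 1/ℕ (classSize s x)

  energy : (A → A → Bool) → (A → ℚ) → ℚ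
  energy s g = ∑ (λ x → 𝔼[ g ∣ s ] x * 𝔼[ g ∣ s ] x) Ω

  module _ {s : A → A → Bool} (s-equiv : IsEquivalenceᵇ s) where

    classSize-resp : ∀ x w → s x w ≡ true → classSize s x ≡ classSize s w
    classSize-resp x w xw = countᵇ-cong Ω (same-class s-equiv x w xw)

    𝔼-resp : ∀ g x w → s x w ≡ true → 𝔼[ g ∣ s ] x ≡ 𝔼[ g ∣ s ] w
    𝔼-resp g x w xw = cong₂ _*_
      (∑-cong Ω (λ v → cong (λ b → 𝟙 b * g v) (same-class s-equiv x w xw v)))
      (cong 1/ℕ (classSize-resp x w xw))

    classSize*1/classSize : ∀ x → x ∈ Ω → fromℕ (classSize s x) * 1/ℕ (classSize s x) ≡ 1ℚ
    classSize*1/classSize x x∈Ω =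
      fromℕ*1/ℕ (classSize s x) {{countᵇ-nonZero (s x) Ω x∈Ω (reflᵇ s-equiv x)}}

    ∑-𝟙*𝔼 : ∀ (σ : A → Bool) → (∀ w v → s w v ≡ true → σ w ≡ σ v) → ∀ g →
            ∑ (λ w → 𝟙 (σ w) * 𝔼[ g ∣ s ] w) Ω ≡ ∑ (λ w → 𝟙 (σ w) * g w) Ω
    ∑-𝟙*𝔼 σ σ-resp g = begin
      ∑ (λ w → 𝟙 (σ w) * 𝔼[ g ∣ s ] w) Ω  ≡⟨ ∑-cong Ω expand ⟩
      ∑ (λ w → ∑ (λ v → F w v) Ω) Ω       ≡⟨ ∑-comm F Ω Ω ⟩
      ∑ (λ v → ∑ (λ w → F w v) Ω) Ω       ≡⟨ ∑-cong-∈ Ω column ⟩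
      ∑ (λ v → 𝟙 (σ v) * g v) Ω           ∎
      where
      open ≡-Reasoning
      open +-*-Solver
      c : A → ℚ
      c w = 1/ℕ (classSize s w)
      F : A → A → ℚ
      F w v = (𝟙 (σ w) * c w) * (𝟙 (s w v) * g v)
      expand : ∀ w → 𝟙 (σ w) * 𝔼[ g ∣ s ] w ≡ ∑ (F w) Ω
      expand w = trans (solve 3 (λ a b d → a :* (b :* d) := (a :* d) :* b) refl (𝟙 (σ w)) (∑ (λ v → 𝟙 (s w v) * g v) Ω) (c w))
                       (sym (∑-*ˡ (𝟙 (σ w) * c w) (λ v → 𝟙 (s w v) * g v) Ω))
      -- F w v depends on w only through s v w, since σ and c are constant on the class of v.
      F-via-class : ∀ v w → F w v ≡ 𝟙 (s v w) * (𝟙 (σ v) * c v * g v)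
      F-via-class v w with s w v in wv
      ... | true rewrite symᵇ s-equiv w v wv | σ-resp w v wv | classSize-resp w v wv =
        solve 3 (λ a b d → (a :* b) :* (con 1ℚ :* d) := con 1ℚ :* (a :* b :* d)) refl (𝟙 (σ v)) (c v) (g v)
      ... | false rewrite symᵇ-false s-equiv w v wv =
        solve 4 (λ a b d e → (a :* b) :* (con 0ℚ :* d) := con 0ℚ :* e) refl (𝟙 (σ w)) (c w) (g v) (𝟙 (σ v) * c v * g v)
      column : ∀ v → v ∈ Ω → ∑ (λ w → F w v) Ω ≡ 𝟙 (σ v) * g v
      column v v∈Ω = begin
        ∑ (λ w → F w v) Ω                                ≡⟨ ∑-cong Ω (F-via-class v) ⟩
        ∑ (λ w → 𝟙 (s v w) * (𝟙 (σ v) * c v * g v)) Ω    ≡⟨ ∑-*ʳ _ (λ w → 𝟙 (s v w)) Ω ⟩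
        ∑ (λ w → 𝟙 (s v w)) Ω * (𝟙 (σ v) * c v * g v)    ≡⟨ cong (_* (𝟙 (σ v) * c v * g v)) (∑-𝟙 (s v) Ω) ⟩
        fromℕ (classSize s v) * (𝟙 (σ v) * c v * g v)    ≡⟨ solve 4 (λ n a b d → n :* (a :* b :* d) := (n :* b) :* (a :* d)) refl (fromℕ (classSize s v)) (𝟙 (σ v)) (c v) (g v) ⟩
        (fromℕ (classSize s v) * c v) * (𝟙 (σ v) * g v)  ≡⟨ cong (_* (𝟙 (σ v) * g v)) (classSize*1/classSize v v∈Ω) ⟩
        1ℚ * (𝟙 (σ v) * g v)                             ≡⟨ *-identityˡ _ ⟩
        𝟙 (σ v) * g v                                    ∎

    ∑-𝔼 : ∀ g → ∑ 𝔼[ g ∣ s ] Ω ≡ ∑ g Ω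
    ∑-𝔼 g = begin
      ∑ 𝔼[ g ∣ s ] Ω                 ≡⟨ ∑-cong Ω (λ w → sym (*-identityˡ (𝔼[ g ∣ s ] w))) ⟩
      ∑ (λ w → 1ℚ * 𝔼[ g ∣ s ] w) Ω  ≡⟨ ∑-𝟙*𝔼 (λ _ → true) (λ _ _ _ → refl) g ⟩
      ∑ (λ w → 1ℚ * g w) Ω           ≡⟨ ∑-cong Ω (λ w → *-identityˡ (g w)) ⟩
      ∑ g Ω                          ∎
      where open ≡-Reasoning

    𝔼-pull-out : ∀ (h : A → ℚ) → (∀ x w → s x w ≡ true → h w ≡ h x) → ∀ g x →
                 𝔼[ (λ w → h w * g w) ∣ s ] x ≡ h x * 𝔼[ g ∣ s ] x
    𝔼-pull-out h h-resp g x = begin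
      ∑ (λ w → 𝟙 (s x w) * (h w * g w)) Ω * 1/ℕ (classSize s x)  ≡⟨ cong (_* 1/ℕ (classSize s x)) (∑-cong Ω pull) ⟩
      ∑ (λ w → h x * (𝟙 (s x w) * g w)) Ω * 1/ℕ (classSize s x)  ≡⟨ cong (_* 1/ℕ (classSize s x)) (∑-*ˡ (h x) _ Ω) ⟩
      h x * ∑ (λ w → 𝟙 (s x w) * g w) Ω * 1/ℕ (classSize s x)    ≡⟨ *-assoc (h x) _ _ ⟩
      h x * 𝔼[ g ∣ s ] x                                         ∎
      where
      open ≡-Reasoning
      open +-*-Solver
      pull : ∀ w → 𝟙 (s x w) * (h w * g w) ≡ h x * (𝟙 (s x w) * g w)
      pull w with s x w in xw
      ... | true rewrite h-resp x w xw = solve 2 (λ a b → con 1ℚ :* (a :* b) := a :* (con 1ℚ :* b)) refl (h x) (g w)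
      ... | false = solve 3 (λ a b c → con 0ℚ :* (a :* b) := c :* (con 0ℚ :* b)) refl (h w) (g w) (h x)

  module _ {s t : A → A → Bool} (s-equiv : IsEquivalenceᵇ s) (t-equiv : IsEquivalenceᵇ t) (t⊑s : t Refines s) where

    𝔼-tower : ∀ g x → 𝔼[ 𝔼[ g ∣ t ] ∣ s ] x ≡ 𝔼[ g ∣ s ] x
    𝔼-tower g x = cong (_* 1/ℕ (classSize s x)) (∑-𝟙*𝔼 t-equiv (s x) s-resp g)
      where
      s-resp : ∀ w v → t w v ≡ true → s x w ≡ s x v
      s-resp w v wv = trans (symmetricᵇ s-equiv x w)
        (trans (same-class s-equiv w v (t⊑s w v wv) x) (symmetricᵇ s-equiv v x))

    ∑-𝔼*𝔼-refine : ∀ g → ∑ (λ x → 𝔼[ g ∣ s ] x * 𝔼[ g ∣ t ] x) Ω ≡ energy s g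
    ∑-𝔼*𝔼-refine g = begin
      ∑ (λ x → 𝔼[ g ∣ s ] x * 𝔼[ g ∣ t ] x) Ω           ≡⟨ sym (∑-𝔼 s-equiv _) ⟩
      ∑ 𝔼[ (λ w → 𝔼[ g ∣ s ] w * 𝔼[ g ∣ t ] w) ∣ s ] Ω  ≡⟨ ∑-cong Ω (𝔼-pull-out s-equiv 𝔼[ g ∣ s ] 𝔼s-resp 𝔼[ g ∣ t ]) ⟩
      ∑ (λ x → 𝔼[ g ∣ s ] x * 𝔼[ 𝔼[ g ∣ t ] ∣ s ] x) Ω  ≡⟨ ∑-cong Ω (λ x → cong (𝔼[ g ∣ s ] x *_) (𝔼-tower g x)) ⟩
      energy s g                                        ∎
      where
      open ≡-Reasoning
      𝔼s-resp : ∀ x w → s x w ≡ true → 𝔼[ g ∣ s ] w ≡ 𝔼[ g ∣ s ] x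
      𝔼s-resp x w xw = sym (𝔼-resp s-equiv g x w xw)

    energy-gap : ∀ g → ∑ (λ x → (𝔼[ g ∣ t ] x - 𝔼[ g ∣ s ] x) * (𝔼[ g ∣ t ] x - 𝔼[ g ∣ s ] x)) Ω ≡ energy t g - energy s g
    energy-gap g = begin
      ∑ (λ x → (a x - b x) * (a x - b x)) Ω                      ≡⟨ ∑-cong Ω (λ x → expand (a x) (b x)) ⟩
      ∑ (λ x → (a x * a x - b x * b x) - (z x + z x)) Ω          ≡⟨ ∑-- _ (λ x → z x + z x) Ω ⟩
      ∑ (λ x → a x * a x - b x * b x) Ω - ∑ (λ x → z x + z x) Ω  ≡⟨ cong₂ _-_ (∑-- _ _ Ω) (∑-+ z z Ω) ⟩
      (energy t g - energy s g) - (∑ z Ω + ∑ z Ω)                ≡⟨ cong (λ q → (energy t g - energy s g) - (q + q)) ∑z≡0 ⟩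
      (energy t g - energy s g) - (0ℚ + 0ℚ)                      ≡⟨ solve 1 (λ q → q :- (con 0ℚ :+ con 0ℚ) := q) refl _ ⟩
      energy t g - energy s g                                    ∎
      where
      open ≡-Reasoning
      open +-*-Solver
      a = 𝔼[ g ∣ t ]
      b = 𝔼[ g ∣ s ]
      z : A → ℚ
      z x = b x * a x - b x * b x
      expand : ∀ p q → (p - q) * (p - q) ≡ (p * p - q * q) - ((q * p - q * q) + (q * p - q * q))
      expand = solve 2 (λ p q → (p :- q) :* (p :- q) := (p :* p :- q :* q) :- ((q :* p :- q :* q) :+ (q :* p :- q :* q))) refl
      ∑z≡0 : ∑ z Ω ≡ 0ℚ
      ∑z≡0 = trans (∑-- _ _ Ω) (trans (cong (_- energy s g) (∑-𝔼*𝔼-refine g)) (+-inverseʳ (energy s g)))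

    energy-mono : ∀ g → energy s g ≤ energy t g
    energy-mono g = begin
      energy s g                              ≡⟨ sym (+-identityʳ _) ⟩
      energy s g + 0ℚ                         ≤⟨ +-monoʳ-≤ (energy s g) (≤-trans 0≤gap (≤-reflexive (energy-gap g))) ⟩
      energy s g + (energy t g - energy s g)  ≡⟨ solve 2 (λ p q → p :+ (q :- p) := q) refl (energy s g) (energy t g) ⟩
      energy t g                              ∎
      where
      open ≤-Reasoning
      open +-*-Solver
      0≤gap = ∑-nonNeg Ω (λ x _ → 0≤p*p (𝔼[ g ∣ t ] x - 𝔼[ g ∣ s ] x))

  module _ (g : A → ℚ) (0≤g : ∀ w → 0ℚ ≤ g w) where

    𝔼-nonNeg : ∀ s x → 0ℚ ≤ 𝔼[ g ∣ s ] x
    𝔼-nonNeg s x = 0≤* (∑-nonNeg Ω (λ w _ → 0≤* (𝟙-nonNeg (s x w)) (0≤g w))) (1/ℕ-nonNeg (classSize s x))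

    energy-nonNeg : ∀ s → 0ℚ ≤ energy s g
    energy-nonNeg s = ∑-nonNeg Ω (λ x _ → 0≤* (𝔼-nonNeg s x) (𝔼-nonNeg s x))

    module _ (g≤1 : ∀ w → g w ≤ 1ℚ) {s : A → A → Bool} (s-equiv : IsEquivalenceᵇ s) where

      𝔼≤1 : ∀ x → x ∈ Ω → 𝔼[ g ∣ s ] x ≤ 1ℚ
      𝔼≤1 x x∈Ω = begin
        ∑ (λ w → 𝟙 (s x w) * g w) Ω * 1/ℕ (classSize s x)  ≤⟨ *-monoʳ-≤-0≤ (1/ℕ-nonNeg (classSize s x)) (∑-mono-≤ Ω 𝟙*g≤𝟙) ⟩
        ∑ (λ w → 𝟙 (s x w)) Ω * 1/ℕ (classSize s x)        ≡⟨ cong (_* 1/ℕ (classSize s x)) (∑-𝟙 (s x) Ω) ⟩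
        fromℕ (classSize s x) * 1/ℕ (classSize s x)        ≡⟨ classSize*1/classSize s-equiv x x∈Ω ⟩
        1ℚ                                                 ∎
        where
        open ≤-Reasoning
        𝟙*g≤𝟙 : ∀ w → w ∈ Ω → 𝟙 (s x w) * g w ≤ 𝟙 (s x w)
        𝟙*g≤𝟙 w _ = ≤-trans (*-monoˡ-≤-0≤ (𝟙-nonNeg (s x w)) (g≤1 w)) (≤-reflexive (*-identityʳ _))

      energy≤size : energy s g ≤ fromℕ (length Ω)
      energy≤size = ≤-trans (∑-mono-≤ Ω (λ x x∈Ω → p*p≤1 (𝔼-nonNeg s x) (𝔼≤1 x x∈Ω))) (≤-reflexive (∑-1 Ω))

-- Coordinates and sums over X^n

module _ {A : Set} where

  projIn : ∀ {m} (I : Vec Bool m) → Vec A m → Vec A (inCount I)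
  projIn []          []      = []
  projIn (true ∷ I)  (a ∷ x) = a ∷ projIn I x
  projIn (false ∷ I) (a ∷ x) = projIn I x

  projIn-merge : ∀ {m} (I : Vec Bool m) y u → projIn I (merge I y u) ≡ y
  projIn-merge []          []      []      = refl
  projIn-merge (true ∷ I)  (a ∷ y) u       = cong (a ∷_) (projIn-merge I y u)
  projIn-merge (false ∷ I) y       (a ∷ u) = projIn-merge I y u

inCount+outCount : ∀ {m} (I : Vec Bool m) → inCount I ℕ.+ outCount I ≡ m
inCount+outCount []          = refl
inCount+outCount (true ∷ I)  = cong suc (inCount+outCount I)
inCount+outCount (false ∷ I) = trans (ℕ.+-suc (inCount I) (outCount I)) (cong suc (inCount+outCount I))

inCount-replicate-false : ∀ m → inCount (replicate m false) ≡ 0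
inCount-replicate-false zero    = refl
inCount-replicate-false (suc m) = inCount-replicate-false m

liftOut : ∀ {m} (I : Vec Bool m) → Vec Bool (outCount I) → Vec Bool m
liftOut []          []      = []
liftOut (true ∷ I)  J       = false ∷ liftOut I J
liftOut (false ∷ I) (b ∷ J) = b ∷ liftOut I J

inCount-liftOut : ∀ {m} (I : Vec Bool m) J → inCount (liftOut I J) ≡ inCount J
inCount-liftOut []          []         = refl
inCount-liftOut (true ∷ I)  J          = inCount-liftOut I J
inCount-liftOut (false ∷ I) (true ∷ J) = cong suc (inCount-liftOut I J)
inCount-liftOut (false ∷ I) (false ∷ J) = inCount-liftOut I J

_∪_ : ∀ {m} → Vec Bool m → Vec Bool m → Vec Bool m
_∪_ = Data.Vec.zipWith _∨_

⋃ : ∀ {m} {Y : Set} → (Y → Vec Bool m) → List Y → Vec Bool m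
⋃ {m} L []       = replicate m false
⋃     L (y ∷ ys) = L y ∪ ⋃ L ys

inCount-∪ : ∀ {m} (I J : Vec Bool m) → inCount (I ∪ J) ℕ.≤ inCount I ℕ.+ inCount J
inCount-∪ []          []          = z≤n
inCount-∪ (true ∷ I)  (true ∷ J)  = s≤s (ℕ.≤-trans (inCount-∪ I J) (ℕ.+-monoʳ-≤ (inCount I) (ℕ.n≤1+n (inCount J))))
inCount-∪ (true ∷ I)  (false ∷ J) = s≤s (inCount-∪ I J)
inCount-∪ (false ∷ I) (true ∷ J)  = ℕ.≤-trans (s≤s (inCount-∪ I J)) (ℕ.≤-reflexive (sym (ℕ.+-suc (inCount I) (inCount J))))
inCount-∪ (false ∷ I) (false ∷ J) = inCount-∪ I J

inCount-∪ˡ : ∀ {m} (I J : Vec Bool m) → inCount I ℕ.≤ inCount (I ∪ J)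
inCount-∪ˡ []          []          = z≤n
inCount-∪ˡ (true ∷ I)  (b ∷ J)     = s≤s (inCount-∪ˡ I J)
inCount-∪ˡ (false ∷ I) (true ∷ J)  = ℕ.m≤n⇒m≤1+n (inCount-∪ˡ I J)
inCount-∪ˡ (false ∷ I) (false ∷ J) = inCount-∪ˡ I J

inCount-⋃ : ∀ {m} {Y : Set} (L : Y → Vec Bool m) {r} → (∀ y → inCount (L y) ℕ.≤ r) → ∀ ys →
            inCount (⋃ L ys) ℕ.≤ length ys ℕ.* r
inCount-⋃ {m} L L≤r []       = ℕ.≤-reflexive (inCount-replicate-false m)
inCount-⋃     L L≤r (y ∷ ys) = ℕ.≤-trans (inCount-∪ (L y) (⋃ L ys)) (ℕ.+-mono-≤ (L≤r y) (inCount-⋃ L L≤r ys))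

module _ {A : Set} where

  projIn-∪ˡ : ∀ {m} (I J : Vec Bool m) (x w : Vec A m) → projIn (I ∪ J) x ≡ projIn (I ∪ J) w → projIn I x ≡ projIn I w
  projIn-∪ˡ []          []          []      []      eq = refl
  projIn-∪ˡ (true ∷ I)  (b ∷ J)     (a ∷ x) (c ∷ w) eq = cong₂ _∷_ (∷-injectiveˡ eq) (projIn-∪ˡ I J x w (∷-injectiveʳ eq))
  projIn-∪ˡ (false ∷ I) (true ∷ J)  (a ∷ x) (c ∷ w) eq = projIn-∪ˡ I J x w (∷-injectiveʳ eq)
  projIn-∪ˡ (false ∷ I) (false ∷ J) (a ∷ x) (c ∷ w) eq = projIn-∪ˡ I J x w eq

  projIn-∪ʳ : ∀ {m} (I J : Vec Bool m) (x w : Vec A m) → projIn (I ∪ J) x ≡ projIn (I ∪ J) w → projIn J x ≡ projIn J w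
  projIn-∪ʳ []          []          []      []      eq = refl
  projIn-∪ʳ (true ∷ I)  (true ∷ J)  (a ∷ x) (c ∷ w) eq = cong₂ _∷_ (∷-injectiveˡ eq) (projIn-∪ʳ I J x w (∷-injectiveʳ eq))
  projIn-∪ʳ (true ∷ I)  (false ∷ J) (a ∷ x) (c ∷ w) eq = projIn-∪ʳ I J x w (∷-injectiveʳ eq)
  projIn-∪ʳ (false ∷ I) (true ∷ J)  (a ∷ x) (c ∷ w) eq = cong₂ _∷_ (∷-injectiveˡ eq) (projIn-∪ʳ I J x w (∷-injectiveʳ eq))
  projIn-∪ʳ (false ∷ I) (false ∷ J) (a ∷ x) (c ∷ w) eq = projIn-∪ʳ I J x w eq

  projIn-⋃ : ∀ {m} {Y : Set} (L : Y → Vec Bool m) ys {y} → y ∈ ys → ∀ (x w : Vec A m) →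
             projIn (⋃ L ys) x ≡ projIn (⋃ L ys) w → projIn (L y) x ≡ projIn (L y) w
  projIn-⋃ L (y ∷ ys) (here refl)  x w eq = projIn-∪ˡ (L y) (⋃ L ys) x w eq
  projIn-⋃ L (y ∷ ys) (there y∈ys) x w eq = projIn-⋃ L ys y∈ys x w (projIn-∪ʳ (L y) (⋃ L ys) x w eq)

module _ {k : ℕ} where

  _==_ : ∀ {m} → Vec (Fin k) m → Vec (Fin k) m → Bool
  x == y = does (≡-dec F._≟_ x y)

  ==⇒≡ : ∀ {m} (x y : Vec (Fin k) m) → x == y ≡ true → x ≡ y
  ==⇒≡ x y x==y with ≡-dec F._≟_ x y
  ... | yes x≡y = x≡y

  ≡⇒== : ∀ {m} {x y : Vec (Fin k) m} → x ≡ y → x == y ≡ true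
  ≡⇒== {x = x} {y} = dec-true (≡-dec F._≟_ x y)

  ∑-allFin-suc : ∀ {n} (f : Fin (suc n) → ℚ) → ∑ f (allFin (suc n)) ≡ f zero + ∑ (f ∘ suc) (allFin n)
  ∑-allFin-suc {n} f = cong (f zero +_) (trans (cong (∑ f) (sym (map-tabulate id suc))) (∑-map f suc (allFin n)))

  ∑-allFin-δ : ∀ {n} (a₀ : Fin n) (G : Fin n → ℚ) → ∑ (λ a → 𝟙 (does (a₀ F.≟ a)) * G a) (allFin n) ≡ G a₀
  ∑-allFin-δ {suc n} zero G = begin
    ∑ (λ a → 𝟙 (does (zero F.≟ a)) * G a) (allFin (suc n))  ≡⟨ ∑-allFin-suc (λ a → 𝟙 (does (zero F.≟ a)) * G a) ⟩
    1ℚ * G zero + ∑ (λ a → 0ℚ * G (suc a)) (allFin n)       ≡⟨ cong (1ℚ * G zero +_) (trans (∑-cong (allFin n) (λ a → *-zeroˡ (G (suc a)))) (∑-0 (allFin n))) ⟩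
    1ℚ * G zero + 0ℚ                                        ≡⟨ trans (+-identityʳ _) (*-identityˡ _) ⟩
    G zero                                                  ∎
    where open ≡-Reasoning
  ∑-allFin-δ {suc n} (suc b) G = begin
    ∑ (λ a → 𝟙 (does (suc b F.≟ a)) * G a) (allFin (suc n))            ≡⟨ ∑-allFin-suc (λ a → 𝟙 (does (suc b F.≟ a)) * G a) ⟩
    0ℚ * G zero + ∑ (λ a → 𝟙 (does (b F.≟ a)) * G (suc a)) (allFin n)  ≡⟨ cong₂ _+_ (*-zeroˡ (G zero)) (∑-allFin-δ b (G ∘ suc)) ⟩
    0ℚ + G (suc b)                                                     ≡⟨ +-identityˡ _ ⟩
    G (suc b)                                                          ∎
    where open ≡-Reasoning

  ∑-allVecs-suc : ∀ m (f : Vec (Fin k) (suc m) → ℚ) →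
                  ∑ f (allVecs k (suc m)) ≡ ∑ (λ a → ∑ (λ y → f (a ∷ y)) (allVecs k m)) (allFin k)
  ∑-allVecs-suc m f = trans (∑-concatMap f (λ a → map (a ∷_) (allVecs k m)) (allFin k))
                            (∑-cong (allFin k) (λ a → ∑-map f (a ∷_) (allVecs k m)))

  ∈-allVecs : ∀ {m} (y : Vec (Fin k) m) → y ∈ allVecs k m
  ∈-allVecs []      = here refl
  ∈-allVecs {suc m} (a ∷ y) = ∈-concatMap⁺ (λ b → map (b ∷_) (allVecs k m)) (lose (∈-allFin a) (∈-map⁺ (a ∷_) (∈-allVecs y)))

  ∑-allVecs-1 : ∀ m → ∑ (λ _ → 1ℚ) (allVecs k m) ≡ fromℕ (k ^ m)
  ∑-allVecs-1 zero    = refl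
  ∑-allVecs-1 (suc m) = begin
    ∑ (λ _ → 1ℚ) (allVecs k (suc m))                 ≡⟨ ∑-allVecs-suc m (λ _ → 1ℚ) ⟩
    ∑ (λ _ → ∑ (λ _ → 1ℚ) (allVecs k m)) (allFin k)  ≡⟨ ∑-cong (allFin k) (λ _ → ∑-allVecs-1 m) ⟩
    ∑ (λ _ → fromℕ (k ^ m)) (allFin k)               ≡⟨ ∑-const (fromℕ (k ^ m)) (allFin k) ⟩
    fromℕ (length (allFin k)) * fromℕ (k ^ m)        ≡⟨ cong (λ l → fromℕ l * fromℕ (k ^ m)) (length-tabulate {n = k} id) ⟩
    fromℕ k * fromℕ (k ^ m)                          ≡⟨ sym (fromℕ-* k (k ^ m)) ⟩
    fromℕ (k ^ suc m)                                ∎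
    where open ≡-Reasoning

  length-allVecs : ∀ m → length (allVecs k m) ≡ k ^ m
  length-allVecs m = fromℕ-injective (trans (sym (∑-1 (allVecs k m))) (∑-allVecs-1 m))

  ∑-allVecs-δ : ∀ {m} (y₀ : Vec (Fin k) m) (G : Vec (Fin k) m → ℚ) → ∑ (λ y → 𝟙 (y₀ == y) * G y) (allVecs k m) ≡ G y₀
  ∑-allVecs-δ []        G = trans (+-identityʳ _) (*-identityˡ (G []))
  ∑-allVecs-δ {suc m} (a₀ ∷ y₀) G = begin
    ∑ (λ y → 𝟙 ((a₀ ∷ y₀) == y) * G y) (allVecs k (suc m))                                    ≡⟨ ∑-allVecs-suc m _ ⟩
    ∑ (λ a → ∑ (λ y → 𝟙 (does (a₀ F.≟ a) ∧ (y₀ == y)) * G (a ∷ y)) (allVecs k m)) (allFin k)   ≡⟨ ∑-cong (allFin k) factor ⟩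
    ∑ (λ a → 𝟙 (does (a₀ F.≟ a)) * ∑ (λ y → 𝟙 (y₀ == y) * G (a ∷ y)) (allVecs k m)) (allFin k) ≡⟨ ∑-cong (allFin k) (λ a → cong (𝟙 (does (a₀ F.≟ a)) *_) (∑-allVecs-δ y₀ (G ∘ (a ∷_)))) ⟩
    ∑ (λ a → 𝟙 (does (a₀ F.≟ a)) * G (a ∷ y₀)) (allFin k)  ≡⟨ ∑-allFin-δ a₀ (λ a → G (a ∷ y₀)) ⟩
    G (a₀ ∷ y₀)                                            ∎
    where
    open ≡-Reasoning
    factor : ∀ a → ∑ (λ y → 𝟙 (does (a₀ F.≟ a) ∧ (y₀ == y)) * G (a ∷ y)) (allVecs k m)
                 ≡ 𝟙 (does (a₀ F.≟ a)) * ∑ (λ y → 𝟙 (y₀ == y) * G (a ∷ y)) (allVecs k m)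
    factor a = trans (∑-cong (allVecs k m) (λ y → trans (cong (_* G (a ∷ y)) (𝟙-∧ (does (a₀ F.≟ a)) (y₀ == y)))
                                                        (*-assoc (𝟙 (does (a₀ F.≟ a))) (𝟙 (y₀ == y)) (G (a ∷ y)))))
                     (∑-*ˡ (𝟙 (does (a₀ F.≟ a))) _ (allVecs k m))

  ∑-allVecs-merge : ∀ {n} (I : Vec Bool n) (f : Vec (Fin k) n → ℚ) →
    ∑ f (allVecs k n) ≡ ∑ (λ y → ∑ (λ u → f (merge I y u)) (allVecs k (outCount I))) (allVecs k (inCount I))
  ∑-allVecs-merge []                f = sym (+-identityʳ (f [] + 0ℚ))
  ∑-allVecs-merge {suc n} (true ∷ I)  f = begin
    ∑ f (allVecs k (suc n))                                                                                        ≡⟨ ∑-allVecs-suc n f ⟩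
    ∑ (λ a → ∑ (λ x → f (a ∷ x)) (allVecs k n)) (allFin k)                                                         ≡⟨ ∑-cong (allFin k) (λ a → ∑-allVecs-merge I (f ∘ (a ∷_))) ⟩
    ∑ (λ a → ∑ (λ y → ∑ (λ u → f (a ∷ merge I y u)) (allVecs k (outCount I))) (allVecs k (inCount I))) (allFin k)  ≡⟨ sym (∑-allVecs-suc (inCount I) _) ⟩
    ∑ (λ y → ∑ (λ u → f (merge (true ∷ I) y u)) (allVecs k (outCount I))) (allVecs k (suc (inCount I)))            ∎
    where open ≡-Reasoning
  ∑-allVecs-merge {suc n} (false ∷ I) f = begin
    ∑ f (allVecs k (suc n))                                                                                        ≡⟨ ∑-allVecs-suc n f ⟩
    ∑ (λ a → ∑ (λ x → f (a ∷ x)) (allVecs k n)) (allFin k)                                                         ≡⟨ ∑-cong (allFin k) (λ a → ∑-allVecs-merge I (f ∘ (a ∷_))) ⟩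
    ∑ (λ a → ∑ (λ y → ∑ (λ u → f (a ∷ merge I y u)) (allVecs k (outCount I))) (allVecs k (inCount I))) (allFin k)  ≡⟨ ∑-comm _ (allFin k) (allVecs k (inCount I)) ⟩
    ∑ (λ y → ∑ (λ a → ∑ (λ u → f (a ∷ merge I y u)) (allVecs k (outCount I))) (allFin k)) (allVecs k (inCount I))  ≡⟨ ∑-cong (allVecs k (inCount I)) (λ y → sym (∑-allVecs-suc (outCount I) _)) ⟩
    ∑ (λ y → ∑ (λ u → f (merge (false ∷ I) y u)) (allVecs k (suc (outCount I)))) (allVecs k (inCount I))           ∎
    where open ≡-Reasoning

  agree : ∀ {m} → Vec Bool m → Vec (Fin k) m → Vec (Fin k) m → Bool
  agree I x w = projIn I x == projIn I w

  agree-isEquivalenceᵇ : ∀ {m} (I : Vec Bool m) → IsEquivalenceᵇ (agree I)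
  agree-isEquivalenceᵇ I = record
    { reflᵇ  = λ x → ≡⇒== {x = projIn I x} refl
    ; symᵇ   = λ x w xw → ≡⇒== (sym (==⇒≡ (projIn I x) (projIn I w) xw))
    ; transᵇ = λ x w v xw wv → ≡⇒== (trans (==⇒≡ (projIn I x) (projIn I w) xw) (==⇒≡ (projIn I w) (projIn I v) wv))
    }

  agree-∪ˡ : ∀ {m} (I J : Vec Bool m) → agree (I ∪ J) Refines agree I
  agree-∪ˡ I J x w xw = ≡⇒== (projIn-∪ˡ I J x w (==⇒≡ (projIn (I ∪ J) x) (projIn (I ∪ J) w) xw))

  agree-∪ʳ : ∀ {m} (I J : Vec Bool m) → agree (I ∪ J) Refines agree J
  agree-∪ʳ I J x w xw = ≡⇒== (projIn-∪ʳ I J x w (==⇒≡ (projIn (I ∪ J) x) (projIn (I ∪ J) w) xw))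

  agree-⋃ : ∀ {m} {Y : Set} (L : Y → Vec Bool m) ys {y} → y ∈ ys → agree (⋃ L ys) Refines agree (L y)
  agree-⋃ L ys y∈ys x w xw = ≡⇒== (projIn-⋃ L ys y∈ys x w (==⇒≡ (projIn (⋃ L ys) x) (projIn (⋃ L ys) w) xw))

  agree-liftOut-merge : ∀ {m} (I : Vec Bool m) J y y′ u u′ → agree (liftOut I J) (merge I y u) (merge I y′ u′) ≡ agree J u u′
  agree-liftOut-merge []          []          []      []        []      []        = refl
  agree-liftOut-merge (true ∷ I)  J           (a ∷ y) (a′ ∷ y′) u       u′        = agree-liftOut-merge I J y y′ u u′
  agree-liftOut-merge (false ∷ I) (true ∷ J)  y       y′        (a ∷ u) (a′ ∷ u′) = cong (does (a F.≟ a′) ∧_) (agree-liftOut-merge I J y y′ u u′)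
  agree-liftOut-merge (false ∷ I) (false ∷ J) y       y′        (a ∷ u) (a′ ∷ u′) = agree-liftOut-merge I J y y′ u u′

  ∑-agree : ∀ {n} (I : Vec Bool n) x (h : Vec (Fin k) n → ℚ) →
            ∑ (λ w → 𝟙 (agree I x w) * h w) (allVecs k n) ≡ ∑ (λ u → h (merge I (projIn I x) u)) (allVecs k (outCount I))
  ∑-agree {n} I x h = begin
    ∑ (λ w → 𝟙 (agree I x w) * h w) (allVecs k n)                                                 ≡⟨ ∑-allVecs-merge I _ ⟩
    ∑ (λ y → ∑ (λ u → 𝟙 (agree I x (merge I y u)) * h (merge I y u)) (allVecs k (outCount I))) Y  ≡⟨ ∑-cong Y factor ⟩
    ∑ (λ y → 𝟙 (projIn I x == y) * ∑ (λ u → h (merge I y u)) (allVecs k (outCount I))) Y               ≡⟨ ∑-allVecs-δ (projIn I x) _ ⟩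
    ∑ (λ u → h (merge I (projIn I x) u)) (allVecs k (outCount I))                                     ∎
    where
    open ≡-Reasoning
    Y = allVecs k (inCount I)
    factor : ∀ y → ∑ (λ u → 𝟙 (agree I x (merge I y u)) * h (merge I y u)) (allVecs k (outCount I))
                 ≡ 𝟙 (projIn I x == y) * ∑ (λ u → h (merge I y u)) (allVecs k (outCount I))
    factor y = trans (∑-cong (allVecs k (outCount I)) (λ u → cong (λ v → 𝟙 (projIn I x == v) * h (merge I y u)) (projIn-merge I y u)))
                     (∑-*ˡ (𝟙 (projIn I x == y)) _ (allVecs k (outCount I)))

-- The energy increment

-- The partition between agree I and agree K: within the fibre over y ∈ X^I, points are
-- further compared on the coordinates J y.
module FibreRefinement {k n} (I : Vec Bool n) (J : Vec (Fin k) (inCount I) → Vec Bool (outCount I)) where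

  L : Vec (Fin k) (inCount I) → Vec Bool n
  L y = liftOut I (J y)

  fibreAgree : Vec (Fin k) n → Vec (Fin k) n → Bool
  fibreAgree x w = agree I x w ∧ agree (L (projIn I x)) x w

  fibreAgree-isEquivalenceᵇ : IsEquivalenceᵇ fibreAgree
  fibreAgree-isEquivalenceᵇ = record
    { reflᵇ  = λ x → cong₂ _∧_ (reflᵇ (equiv I) x) (reflᵇ (equiv (L (projIn I x))) x)
    ; symᵇ   = λ x w xw → cong₂ _∧_ (symᵇ (equiv I) x w (∧-conicalˡ _ _ xw))
        (subst (λ y → agree (L y) w x ≡ true) (sameFibre x w xw) (symᵇ (equiv (L (projIn I x))) x w (∧-conicalʳ _ _ xw)))
    ; transᵇ = λ x w v xw wv → cong₂ _∧_ (transᵇ (equiv I) x w v (∧-conicalˡ _ _ xw) (∧-conicalˡ _ _ wv))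
        (transᵇ (equiv (L (projIn I x))) x w v (∧-conicalʳ _ _ xw)
          (subst (λ y → agree (L y) w v ≡ true) (sym (sameFibre x w xw)) (∧-conicalʳ _ _ wv)))
    }
    where
    equiv = agree-isEquivalenceᵇ
    sameFibre : ∀ x w → fibreAgree x w ≡ true → projIn I x ≡ projIn I w
    sameFibre x w xw = ==⇒≡ (projIn I x) (projIn I w) (∧-conicalˡ _ _ xw)

  fibreAgree-refines-agree : fibreAgree Refines agree I
  fibreAgree-refines-agree x w = ∧-conicalˡ _ _

  K : Vec Bool n
  K = I ∪ ⋃ L (allVecs k (inCount I))

  agree-K-refines-fibreAgree : agree K Refines fibreAgree
  agree-K-refines-fibreAgree x w xw = cong₂ _∧_ (agree-∪ˡ I _ x w xw)
    (agree-⋃ L (allVecs k (inCount I)) (∈-allVecs (projIn I x)) x w (agree-∪ʳ I _ x w xw))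

  inCount-K : ∀ {r} → (∀ y → inCount (J y) ℕ.≤ r) → inCount K ℕ.≤ inCount I ℕ.+ k ^ inCount I ℕ.* r
  inCount-K {r} J≤r = ℕ.≤-trans (inCount-∪ I _) (ℕ.+-monoʳ-≤ (inCount I) (ℕ.≤-trans
    (inCount-⋃ L (λ y → ℕ.≤-trans (ℕ.≤-reflexive (inCount-liftOut I (J y))) (J≤r y)) (allVecs k (inCount I)))
    (ℕ.≤-reflexive (cong (ℕ._* r) (length-allVecs (inCount I))))))

  ∑-fibreAgree : ∀ y z v (h : Vec (Fin k) n → ℚ) →
    ∑ (λ w → 𝟙 (fibreAgree (merge I y (merge (J y) z v)) w) * h w) (allVecs k n)
      ≡ ∑ (λ v′ → h (merge I y (merge (J y) z v′))) (allVecs k (outCount (J y)))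
  ∑-fibreAgree y z v h = begin
    ∑ (λ w → 𝟙 (fibreAgree x w) * h w) (allVecs k n)
      ≡⟨ ∑-cong (allVecs k n) (λ w → trans (cong (_* h w) (𝟙-∧ (agree I x w) _)) (*-assoc (𝟙 (agree I x w)) _ (h w))) ⟩
    ∑ (λ w → 𝟙 (agree I x w) * (𝟙 (agree (L (projIn I x)) x w) * h w)) (allVecs k n)
      ≡⟨ ∑-agree I x _ ⟩
    ∑ (λ u′ → 𝟙 (agree (L (projIn I x)) x (merge I (projIn I x) u′)) * h (merge I (projIn I x) u′)) (allVecs k (outCount I))
      ≡⟨ cong (λ p → ∑ (λ u′ → 𝟙 (agree (L p) x (merge I p u′)) * h (merge I p u′)) (allVecs k (outCount I))) (projIn-merge I y u) ⟩
    ∑ (λ u′ → 𝟙 (agree (L y) x (merge I y u′)) * h (merge I y u′)) (allVecs k (outCount I))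
      ≡⟨ ∑-cong (allVecs k (outCount I)) (λ u′ → cong (λ b → 𝟙 b * h (merge I y u′)) (agree-liftOut-merge I (J y) y y u u′)) ⟩
    ∑ (λ u′ → 𝟙 (agree (J y) u u′) * h (merge I y u′)) (allVecs k (outCount I))
      ≡⟨ ∑-agree (J y) u (h ∘ merge I y) ⟩
    ∑ (λ v′ → h (merge I y (merge (J y) (projIn (J y) u) v′))) (allVecs k (outCount (J y)))
      ≡⟨ cong (λ p → ∑ (λ v′ → h (merge I y (merge (J y) p v′))) (allVecs k (outCount (J y)))) (projIn-merge (J y) z v) ⟩
    ∑ (λ v′ → h (merge I y (merge (J y) z v′))) (allVecs k (outCount (J y)))
      ∎
    where
    open ≡-Reasoning
    u = merge (J y) z v
    x = merge I y u

density≡∑𝟙 : ∀ k .{{_ : NonZero k}} m (F : Vec (Fin k) m → Bool) →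
             density k m F ≡ ∑ (𝟙 ∘ F) (allVecs k m) * 1/ℕ (k ^ m)
density≡∑𝟙 k m F = trans (/≡fromℕ*1/ℕ (countᵇ F (allVecs k m)) (k ^ m) {{ℕ.m^n≢0 k m}})
                         (cong (_* 1/ℕ (k ^ m)) (sym (∑-𝟙 F (allVecs k m))))

module Energy (k : ℕ) .{{_ : NonZero k}} {n} (E : Vec (Fin k) n → Bool) where

  open ConditionalExpectation (allVecs k n) public

  𝟙E : Vec (Fin k) n → ℚ
  𝟙E w = 𝟙 (E w)

  𝔼≡density : ∀ {s : Vec (Fin k) n → Vec (Fin k) n → Bool} {x m} (e : Vec (Fin k) m → Vec (Fin k) n) →
              (∀ h → ∑ (λ w → 𝟙 (s x w) * h w) (allVecs k n) ≡ ∑ (h ∘ e) (allVecs k m)) →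
              𝔼[ 𝟙E ∣ s ] x ≡ density k m (E ∘ e)
  𝔼≡density {s} {x} {m} e ∑-class = begin
    ∑ (λ w → 𝟙 (s x w) * 𝟙E w) (allVecs k n) * 1/ℕ (classSize s x)  ≡⟨ cong₂ _*_ (∑-class 𝟙E) (cong 1/ℕ classSize≡) ⟩
    ∑ (𝟙E ∘ e) (allVecs k m) * 1/ℕ (k ^ m)                          ≡⟨ sym (density≡∑𝟙 k m (E ∘ e)) ⟩
    density k m (E ∘ e)                                             ∎
    where
    open ≡-Reasoning
    classSize≡ : classSize s x ≡ k ^ m
    classSize≡ = fromℕ-injective (begin
      fromℕ (classSize s x)                   ≡⟨ sym (∑-𝟙 (s x) (allVecs k n)) ⟩
      ∑ (λ w → 𝟙 (s x w)) (allVecs k n)       ≡⟨ sym (∑-cong (allVecs k n) (λ w → *-identityʳ (𝟙 (s x w)))) ⟩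
      ∑ (λ w → 𝟙 (s x w) * 1ℚ) (allVecs k n)  ≡⟨ ∑-class (λ _ → 1ℚ) ⟩
      ∑ (λ _ → 1ℚ) (allVecs k m)              ≡⟨ ∑-allVecs-1 m ⟩
      fromℕ (k ^ m)                           ∎)

  𝔼-agree : ∀ I x → 𝔼[ 𝟙E ∣ agree I ] x ≡ density k (outCount I) (restrict E I (projIn I x))
  𝔼-agree I x = 𝔼≡density {agree I} (merge I (projIn I x)) (∑-agree I x)

  module _ (I : Vec Bool n) (J : Vec (Fin k) (inCount I) → Vec Bool (outCount I)) where
    open FibreRefinement I J

    𝔼-fibreAgree : ∀ y z v → 𝔼[ 𝟙E ∣ fibreAgree ] (merge I y (merge (J y) z v))
                             ≡ density k (outCount (J y)) (restrict (restrict E I y) (J y) z)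
    𝔼-fibreAgree y z v = 𝔼≡density {fibreAgree} {merge I y (merge (J y) z v)} (merge I y ∘ merge (J y) z) (∑-fibreAgree y z v)

module _ {A : Set} (P : A → Bool) where

  firstFailure : List A → Maybe A
  firstFailure []       = nothing
  firstFailure (x ∷ xs) = if P x then firstFailure xs else just x

  firstFailure-sound : ∀ xs {a} → firstFailure xs ≡ just a → P a ≡ false
  firstFailure-sound (x ∷ xs) found with P x in Px
  ... | true  = firstFailure-sound xs found
  firstFailure-sound (x ∷ xs) refl | false = Px

  allᵇ-false⇒firstFailure : ∀ xs → allᵇ P xs ≡ false → ∃ λ a → firstFailure xs ≡ just a
  allᵇ-false⇒firstFailure (x ∷ xs) fails with P x
  ... | true  = allᵇ-false⇒firstFailure xs fails
  ... | false = x , refl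

  allᵇ-false⇒∃ : ∀ xs → allᵇ P xs ≡ false → ∃ λ a → P a ≡ false
  allᵇ-false⇒∃ xs fails with allᵇ-false⇒firstFailure xs fails
  ... | a , found = a , firstFailure-sound xs found

not-∨-false : ∀ a {b} → not a ∨ b ≡ false → a ≡ true × b ≡ false
not-∨-false true b≡false = refl , b≡false

does-false⇒¬ : ∀ {P : Set} (P? : Dec P) → does P? ≡ false → ¬ P
does-false⇒¬ (no ¬p) _ = ¬p

module DeviationWitness (k : ℕ) .{{_ : NonZero k}} (r : ℕ) (β : ℚ) where

  closeAt : ∀ m (F : Vec (Fin k) m → Bool) (J : Vec Bool m) → Vec (Fin k) (inCount J) → Bool
  closeAt m F J z = does (∣ density k (outCount J) (restrict F J z) - density k m F ∣ ≤? β)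

  -- pseudorandomᵇ k m r β F unfolds to allᵇ (passesAt m F) (allSubsets m).
  passesAt : ∀ m → (Vec (Fin k) m → Bool) → Vec Bool m → Bool
  passesAt m F J = not (inCount J ℕ.≤ᵇ r) ∨ allᵇ (closeAt m F J) (allVecs k (inCount J))

  witnessSet : ∀ {m} → (Vec (Fin k) m → Bool) → Vec Bool m
  witnessSet {m} F = fromMaybe (replicate m false) (firstFailure (passesAt m F) (allSubsets m))

  inCount-witnessSet : ∀ {m} (F : Vec (Fin k) m → Bool) → inCount (witnessSet F) ℕ.≤ r
  inCount-witnessSet {m} F with firstFailure (passesAt m F) (allSubsets m) in found
  ... | just J  = ℕ.≤ᵇ⇒≤ (inCount J) r (subst T (sym (proj₁ (not-∨-false _ (firstFailure-sound (passesAt m F) (allSubsets m) found)))) tt)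
  ... | nothing = ℕ.≤-trans (ℕ.≤-reflexive (inCount-replicate-false m)) z≤n

  Deviates : ∀ {m} → (Vec (Fin k) m → Bool) → Vec Bool m → Set
  Deviates {m} F J = ∃ λ z → β < ∣ density k (outCount J) (restrict F J z) - density k m F ∣

  witnessSet-deviates : ∀ {m} (F : Vec (Fin k) m → Bool) → pseudorandomᵇ k m r β F ≡ false → Deviates F (witnessSet F)
  witnessSet-deviates {m} F notPR =
    subst (Deviates F) (sym (cong (fromMaybe (replicate m false)) found)) (z , ≰⇒> (does-false⇒¬ (_ ≤? β) z-fails))
    where
    J = proj₁ (allᵇ-false⇒firstFailure (passesAt m F) (allSubsets m) notPR)
    found = proj₂ (allᵇ-false⇒firstFailure (passesAt m F) (allSubsets m) notPR)
    J-fails : passesAt m F J ≡ false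
    J-fails = firstFailure-sound (passesAt m F) (allSubsets m) found
    witness = allᵇ-false⇒∃ (closeAt m F J) (allVecs k (inCount J)) (proj₂ (not-∨-false (inCount J ℕ.≤ᵇ r) J-fails))
    z = proj₁ witness
    z-fails : closeAt m F J z ≡ false
    z-fails = proj₂ witness

module EnergyIncrement (k : ℕ) .{{_ : NonZero k}} {n} (E : Vec (Fin k) n → Bool) (r : ℕ) (β : ℚ) (0≤β : 0ℚ ≤ β)
                       (I : Vec Bool n) where

  open Energy k E
  open DeviationWitness k r β

  J : Vec (Fin k) (inCount I) → Vec Bool (outCount I)
  J y = witnessSet (restrict E I y)

  open FibreRefinement I J public using (L; K; inCount-K)
  open FibreRefinement I J using (fibreAgree; fibreAgree-isEquivalenceᵇ; fibreAgree-refines-agree; agree-K-refines-fibreAgree)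

  bad : Vec (Fin k) (inCount I) → Bool
  bad y = not (pseudorandomᵇ k (outCount I) r β (restrict E I y))

  badCount : ℕ
  badCount = countᵇ bad (allVecs k (inCount I))

  gap : Vec (Fin k) n → ℚ
  gap x = (𝔼[ 𝟙E ∣ fibreAgree ] x - 𝔼[ 𝟙E ∣ agree I ] x) * (𝔼[ 𝟙E ∣ fibreAgree ] x - 𝔼[ 𝟙E ∣ agree I ] x)

  perBadFibre : ℚ
  perBadFibre = fromℕ (k ^ outCount I) * 1/ℕ (k ^ r) * (β * β)

  fibreSize-bound : ∀ y → fromℕ (k ^ outCount I) * 1/ℕ (k ^ r) ≤ fromℕ (k ^ outCount (J y))
  fibreSize-bound y = begin
    fromℕ (k ^ outCount I) * 1/ℕ (k ^ r)                      ≤⟨ *-monoʳ-≤-0≤ (1/ℕ-nonNeg (k ^ r)) (fromℕ-mono-≤ k^out≤) ⟩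
    fromℕ (k ^ r ℕ.* k ^ outCount (J y)) * 1/ℕ (k ^ r)        ≡⟨ cong (_* 1/ℕ (k ^ r)) (fromℕ-* (k ^ r) _) ⟩
    fromℕ (k ^ r) * fromℕ (k ^ outCount (J y)) * 1/ℕ (k ^ r)  ≡⟨ solve 3 (λ a b c → a :* b :* c := (a :* c) :* b) refl (fromℕ (k ^ r)) _ (1/ℕ (k ^ r)) ⟩
    fromℕ (k ^ r) * 1/ℕ (k ^ r) * fromℕ (k ^ outCount (J y))  ≡⟨ cong (_* fromℕ (k ^ outCount (J y))) (fromℕ*1/ℕ (k ^ r) {{ℕ.m^n≢0 k r}}) ⟩
    1ℚ * fromℕ (k ^ outCount (J y))                           ≡⟨ *-identityˡ _ ⟩
    fromℕ (k ^ outCount (J y))                                ∎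
    where
    open ≤-Reasoning
    open +-*-Solver
    k^out≤ : k ^ outCount I ℕ.≤ k ^ r ℕ.* k ^ outCount (J y)
    k^out≤ = ℕ.≤-trans (ℕ.≤-reflexive (trans (cong (k ^_) (sym (inCount+outCount (J y)))) (ℕ.^-distribˡ-+-* k (inCount (J y)) _)))
                       (ℕ.*-monoˡ-≤ (k ^ outCount (J y)) (ℕ.^-monoʳ-≤ k (inCount-witnessSet (restrict E I y))))

  gap-nonNeg : ∀ x → 0ℚ ≤ gap x
  gap-nonNeg x = 0≤p*p (𝔼[ 𝟙E ∣ fibreAgree ] x - 𝔼[ 𝟙E ∣ agree I ] x)

  -- On a bad fibre y, the cell of the witness z has k^|[n] \ (I ∪ J y)| points, on each of which
  -- the two averages differ by the deviation of E_{I→y} at z.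
  badFibre-gap : ∀ y → pseudorandomᵇ k (outCount I) r β (restrict E I y) ≡ false →
                 perBadFibre ≤ ∑ (λ u → gap (merge I y u)) (allVecs k (outCount I))
  badFibre-gap y notPR = begin
    fromℕ (k ^ outCount I) * 1/ℕ (k ^ r) * (β * β)       ≤⟨ *-monoʳ-≤-0≤ (0≤* 0≤β 0≤β) (fibreSize-bound y) ⟩
    fromℕ (k ^ outCount (J y)) * (β * β)                 ≤⟨ *-monoˡ-≤-0≤ (fromℕ-nonNeg (k ^ outCount (J y))) (0≤p<∣q∣⇒p*p≤q*q 0≤β β<∣δ∣) ⟩
    fromℕ (k ^ outCount (J y)) * (δ * δ)                 ≡⟨ cong (_* (δ * δ)) (sym (∑-allVecs-1 (outCount (J y)))) ⟩
    ∑ (λ _ → 1ℚ) (allVecs k (outCount (J y))) * (δ * δ)  ≡⟨ sym (∑-*ʳ (δ * δ) (λ _ → 1ℚ) (allVecs k (outCount (J y)))) ⟩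
    ∑ (λ _ → 1ℚ * (δ * δ)) (allVecs k (outCount (J y)))  ≡⟨ ∑-cong (allVecs k (outCount (J y))) (λ v → trans (*-identityˡ (δ * δ)) (sym (gap≡δ*δ v))) ⟩
    ∑ (λ v → gap (merge I y (merge (J y) z v))) (allVecs k (outCount (J y)))
      ≤⟨ term≤∑ (allVecs k (inCount (J y))) (∈-allVecs z) (λ z′ _ → ∑-nonNeg (allVecs k (outCount (J y))) (λ v _ → gap-nonNeg (merge I y (merge (J y) z′ v)))) ⟩
    ∑ (λ z′ → ∑ (λ v → gap (merge I y (merge (J y) z′ v))) (allVecs k (outCount (J y)))) (allVecs k (inCount (J y)))
      ≡⟨ sym (∑-allVecs-merge (J y) (gap ∘ merge I y)) ⟩
    ∑ (λ u → gap (merge I y u)) (allVecs k (outCount I))       ∎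
    where
    open ≤-Reasoning
    z = proj₁ (witnessSet-deviates (restrict E I y) notPR)
    β<∣δ∣ = proj₂ (witnessSet-deviates (restrict E I y) notPR)
    δ : ℚ
    δ = density k (outCount (J y)) (restrict (restrict E I y) (J y) z) - density k (outCount I) (restrict E I y)
    gap≡δ*δ : ∀ v → gap (merge I y (merge (J y) z v)) ≡ δ * δ
    gap≡δ*δ v = cong (λ q → q * q) (cong₂ _-_ (𝔼-fibreAgree I J y z v)
      (trans (𝔼-agree I x) (cong (λ p → density k (outCount I) (restrict E I p)) (projIn-merge I y (merge (J y) z v)))))
      where x = merge I y (merge (J y) z v)

  fibre-gap : ∀ y → 𝟙 (bad y) * perBadFibre ≤ ∑ (λ u → gap (merge I y u)) (allVecs k (outCount I))
  fibre-gap y = by-cases (pseudorandomᵇ k (outCount I) r β (restrict E I y)) refl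
    where
    by-cases : ∀ b → pseudorandomᵇ k (outCount I) r β (restrict E I y) ≡ b →
               𝟙 (not b) * perBadFibre ≤ ∑ (λ u → gap (merge I y u)) (allVecs k (outCount I))
    by-cases true  _     = ≤-trans (≤-reflexive (*-zeroˡ perBadFibre)) (∑-nonNeg (allVecs k (outCount I)) (λ u _ → gap-nonNeg (merge I y u)))
    by-cases false notPR = ≤-trans (≤-reflexive (*-identityˡ perBadFibre)) (badFibre-gap y notPR)

  badCount*perBadFibre≤∑gap : fromℕ badCount * perBadFibre ≤ ∑ gap (allVecs k n)
  badCount*perBadFibre≤∑gap = begin
    fromℕ badCount * perBadFibre                                                            ≡⟨ cong (_* perBadFibre) (sym (∑-𝟙 bad (allVecs k (inCount I)))) ⟩
    ∑ (λ y → 𝟙 (bad y)) (allVecs k (inCount I)) * perBadFibre                               ≡⟨ sym (∑-*ʳ perBadFibre (𝟙 ∘ bad) (allVecs k (inCount I))) ⟩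
    ∑ (λ y → 𝟙 (bad y) * perBadFibre) (allVecs k (inCount I))                               ≤⟨ ∑-mono-≤ (allVecs k (inCount I)) (λ y _ → fibre-gap y) ⟩
    ∑ (λ y → ∑ (λ u → gap (merge I y u)) (allVecs k (outCount I))) (allVecs k (inCount I))  ≡⟨ sym (∑-allVecs-merge I gap) ⟩
    ∑ gap (allVecs k n)                                                                     ∎
    where open ≤-Reasoning

  energy-increment : energy (agree I) 𝟙E + fromℕ badCount * perBadFibre ≤ energy (agree K) 𝟙E
  energy-increment = begin
    energy (agree I) 𝟙E + fromℕ badCount * perBadFibre                  ≤⟨ +-monoʳ-≤ (energy (agree I) 𝟙E) badCount*perBadFibre≤∑gap ⟩
    energy (agree I) 𝟙E + ∑ gap (allVecs k n)                           ≡⟨ cong (energy (agree I) 𝟙E +_) ∑gap≡ ⟩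
    energy (agree I) 𝟙E + (energy fibreAgree 𝟙E - energy (agree I) 𝟙E)  ≡⟨ solve 2 (λ p q → p :+ (q :- p) := q) refl (energy (agree I) 𝟙E) (energy fibreAgree 𝟙E) ⟩
    energy fibreAgree 𝟙E                                                ≤⟨ energy-mono fibreAgree-isEquivalenceᵇ (agree-isEquivalenceᵇ K) agree-K-refines-fibreAgree 𝟙E ⟩
    energy (agree K) 𝟙E                                                 ∎
    where
    open ≤-Reasoning
    open +-*-Solver
    ∑gap≡ = energy-gap (agree-isEquivalenceᵇ I) fibreAgree-isEquivalenceᵇ fibreAgree-refines-agree 𝟙E

  ¬probNotPR≤α⇒α*k^|I|≤badCount : ∀ α → ¬ (probNotPR k r β E I ≤ α) → α * fromℕ (k ^ inCount I) ≤ fromℕ badCount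
  ¬probNotPR≤α⇒α*k^|I|≤badCount α notSmall = begin
    α * k^in                                       ≤⟨ *-monoʳ-≤-0≤ (fromℕ-nonNeg (k ^ inCount I)) (<⇒≤ α<prob) ⟩
    fromℕ badCount * 1/ℕ (k ^ inCount I) * k^in    ≡⟨ solve 3 (λ a b c → a :* b :* c := a :* (c :* b)) refl (fromℕ badCount) (1/ℕ (k ^ inCount I)) k^in ⟩
    fromℕ badCount * (k^in * 1/ℕ (k ^ inCount I))  ≡⟨ cong (fromℕ badCount *_) (fromℕ*1/ℕ (k ^ inCount I)) ⟩
    fromℕ badCount * 1ℚ                            ≡⟨ *-identityʳ _ ⟩
    fromℕ badCount                                 ∎
    where
    open ≤-Reasoning
    open +-*-Solver
    instance _ = ℕ.m^n≢0 k (inCount I)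
    k^in = fromℕ (k ^ inCount I)
    α<density : α < density k (inCount I) bad
    α<density = ≰⇒> notSmall
    α<prob : α < fromℕ badCount * 1/ℕ (k ^ inCount I)
    α<prob = subst (α <_) (/≡fromℕ*1/ℕ badCount (k ^ inCount I)) α<density

  ¬probNotPR≤α⇒energy-increment : ∀ α → ¬ (probNotPR k r β E I ≤ α) →
    energy (agree I) 𝟙E + α * (β * β) * 1/ℕ (k ^ r) * fromℕ (k ^ n) ≤ energy (agree K) 𝟙E
  ¬probNotPR≤α⇒energy-increment α notSmall = ≤-trans (+-monoʳ-≤ (energy (agree I) 𝟙E) (begin
    α * (β * β) * 1/ℕ (k ^ r) * fromℕ (k ^ n)   ≡⟨ cong (α * (β * β) * 1/ℕ (k ^ r) *_) k^n≡ ⟩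
    α * (β * β) * 1/ℕ (k ^ r) * (k^in * k^out)  ≡⟨ solve 5 (λ a b v p q → a :* (b :* b) :* v :* (p :* q) := a :* p :* (q :* v :* (b :* b))) refl α β (1/ℕ (k ^ r)) k^in k^out ⟩
    α * k^in * perBadFibre                      ≤⟨ *-monoʳ-≤-0≤ perBadFibre-nonNeg (¬probNotPR≤α⇒α*k^|I|≤badCount α notSmall) ⟩
    fromℕ badCount * perBadFibre                      ∎)) energy-increment
    where
    open ≤-Reasoning
    open +-*-Solver
    k^in = fromℕ (k ^ inCount I)
    k^out = fromℕ (k ^ outCount I)
    k^n≡ : fromℕ (k ^ n) ≡ k^in * k^out
    k^n≡ = trans (cong (λ m → fromℕ (k ^ m)) (sym (inCount+outCount I)))
                 (trans (cong fromℕ (ℕ.^-distribˡ-+-* k (inCount I) (outCount I))) (fromℕ-* (k ^ inCount I) (k ^ outCount I)))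
    perBadFibre-nonNeg : 0ℚ ≤ perBadFibre
    perBadFibre-nonNeg = 0≤* (0≤* (fromℕ-nonNeg (k ^ outCount I)) (1/ℕ-nonNeg (k ^ r))) (0≤p*p β)

-- Iteration

grow : ℕ → ℕ → ℕ → ℕ
grow k r s = s ℕ.+ k ^ s ℕ.* r

iterate-grow-≥ : ∀ k r s m → s ℕ.≤ iterate (grow k r) s m
iterate-grow-≥ k r s zero    = ℕ.≤-refl
iterate-grow-≥ k r s (suc m) = ℕ.≤-trans (ℕ.m≤m+n s _) (iterate-grow-≥ k r (grow k r s) m)

module Search (k : ℕ) .{{_ : NonZero k}} (d r : ℕ) (β α : ℚ) (0≤β : 0ℚ ≤ β) {n} (E : Fin d → Vec (Fin k) n → Bool) where

  energyOf : Fin d → Vec Bool n → ℚ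
  energyOf j I = Energy.energy k (E j) (agree I) (Energy.𝟙E k (E j))

  totalEnergy : Vec Bool n → ℚ
  totalEnergy I = ∑ (λ j → energyOf j I) (allFin d)

  energyOf-∪ : ∀ j I B → energyOf j I ≤ energyOf j (I ∪ B)
  energyOf-∪ j I B = Energy.energy-mono k (E j) (agree-isEquivalenceᵇ I) (agree-isEquivalenceᵇ (I ∪ B)) (agree-∪ˡ I B) (Energy.𝟙E k (E j))

  totalEnergy-nonNeg : ∀ I → 0ℚ ≤ totalEnergy I
  totalEnergy-nonNeg I = ∑-nonNeg (allFin d) (λ j _ → Energy.energy-nonNeg k (E j) (Energy.𝟙E k (E j)) (λ w → 𝟙-nonNeg (E j w)) (agree I))

  totalEnergy≤ : ∀ I → totalEnergy I ≤ fromℕ d * fromℕ (k ^ n)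
  totalEnergy≤ I = begin
    totalEnergy I                              ≤⟨ ∑-mono-≤ (allFin d) (λ j _ → energyOf≤ j) ⟩
    ∑ (λ _ → fromℕ (k ^ n)) (allFin d)         ≡⟨ ∑-const (fromℕ (k ^ n)) (allFin d) ⟩
    fromℕ (length (allFin d)) * fromℕ (k ^ n)  ≡⟨ cong (λ l → fromℕ l * fromℕ (k ^ n)) (length-tabulate {n = d} id) ⟩
    fromℕ d * fromℕ (k ^ n)                    ∎
    where
    open ≤-Reasoning
    energyOf≤ : ∀ j → energyOf j I ≤ fromℕ (k ^ n)
    energyOf≤ j = ≤-trans (Energy.energy≤size k (E j) (Energy.𝟙E k (E j)) (λ w → 𝟙-nonNeg (E j w)) (λ w → 𝟙≤1 (E j w)) (agree-isEquivalenceᵇ I))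
                          (≤-reflexive (cong fromℕ (length-allVecs n)))

  increment : ℚ
  increment = α * (β * β) * 1/ℕ (k ^ r) * fromℕ (k ^ n)

  Good : Vec Bool n → Set
  Good I = ∀ j → probNotPR k r β (E j) I ≤ α

  Improvement : Vec Bool n → Set
  Improvement I = ∃ λ K → (totalEnergy I + increment ≤ totalEnergy K) × (inCount I ℕ.≤ inCount K) ×
                          (inCount K ℕ.≤ inCount I ℕ.+ k ^ inCount I ℕ.* r)

  improve : ∀ I j₀ → ¬ (probNotPR k r β (E j₀) I ≤ α) → Improvement I
  improve I j₀ notSmall = K , ∑-mono-≤-gain (allFin d) (∈-allFin j₀) (λ j → energyOf-∪ j I B) (¬probNotPR≤α⇒energy-increment α notSmall) ,
                          inCount-∪ˡ I B , inCount-K (λ y → inCount-witnessSet (restrict (E j₀) I y))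
    where
    open EnergyIncrement k (E j₀) r β 0≤β I
    open DeviationWitness k r β using (inCount-witnessSet)
    B = ⋃ L (allVecs k (inCount I))

  GoodWithin : ℕ → Set
  GoodWithin C = ∃ λ I → (0 ℕ.< inCount I) × (inCount I ℕ.≤ C) × Good I

  search : ∀ m s I → 0 ℕ.< inCount I → inCount I ℕ.≤ s → fromℕ d * fromℕ (k ^ n) < totalEnergy I + fromℕ m * increment →
           GoodWithin (iterate (grow k r) s m)
  search zero s I _ _ bound< = ⊥-elim (<-irrefl refl (<-≤-trans bound< (begin
    totalEnergy I + 0ℚ * increment  ≡⟨ cong (totalEnergy I +_) (*-zeroˡ increment) ⟩
    totalEnergy I + 0ℚ              ≡⟨ +-identityʳ (totalEnergy I) ⟩
    totalEnergy I                   ≤⟨ totalEnergy≤ I ⟩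
    fromℕ d * fromℕ (k ^ n)         ∎)))
    where open ≤-Reasoning
  search (suc m) s I 0<|I| |I|≤s bound< = decide (all? (λ j → probNotPR k r β (E j) I ≤? α))
    where
    continue : Improvement I → GoodWithin (iterate (grow k r) s (suc m))
    continue (K , gain , |I|≤|K| , |K|≤) = search m (grow k r s) K (ℕ.<-≤-trans 0<|I| |I|≤|K|) |K|≤grow (<-≤-trans bound< step)
      where
      open ≤-Reasoning
      open +-*-Solver
      |K|≤grow : inCount K ℕ.≤ grow k r s
      |K|≤grow = ℕ.≤-trans |K|≤ (ℕ.+-mono-≤ |I|≤s (ℕ.*-monoˡ-≤ r (ℕ.^-monoʳ-≤ k |I|≤s)))
      step : totalEnergy I + fromℕ (suc m) * increment ≤ totalEnergy K + fromℕ m * increment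
      step = begin
        totalEnergy I + fromℕ (suc m) * increment        ≡⟨ cong (λ q → totalEnergy I + q * increment) (fromℕ-+ 1 m) ⟩
        totalEnergy I + (1ℚ + fromℕ m) * increment       ≡⟨ solve 3 (λ e m δ → e :+ (con 1ℚ :+ m) :* δ := e :+ δ :+ m :* δ) refl (totalEnergy I) (fromℕ m) increment ⟩
        totalEnergy I + increment + fromℕ m * increment  ≤⟨ +-monoˡ-≤ (fromℕ m * increment) gain ⟩
        totalEnergy K + fromℕ m * increment              ∎
    decide : Dec (Good I) → GoodWithin (iterate (grow k r) s (suc m))
    decide (yes good)   = I , 0<|I| , ℕ.≤-trans |I|≤s (iterate-grow-≥ k r s (suc m)) , good
    decide (no notGood) = continue (improve I (proj₁ someBad) (proj₂ someBad))
      where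
      someBad = ¬∀⟶∃¬ d (λ j → probNotPR k r β (E j) I ≤ α) (λ j → probNotPR k r β (E j) I ≤? α) notGood

  enoughFuel : ∀ M → fromℕ (d ℕ.* k ^ r) < fromℕ M * (α * (β * β)) → ∀ I →
               fromℕ d * fromℕ (k ^ n) < totalEnergy I + fromℕ M * increment
  enoughFuel M d*k^r<M*q I = begin-strict
    fromℕ d * fromℕ (k ^ n)              ≡⟨ sym d*k^r*c≡ ⟩
    fromℕ (d ℕ.* k ^ r) * c              <⟨ *-monoˡ-<-pos c {{c-pos}} d*k^r<M*q ⟩
    fromℕ M * (α * (β * β)) * c          ≡⟨ solve 5 (λ m a b i p → m :* (a :* (b :* b)) :* (i :* p) := m :* (a :* (b :* b) :* i :* p)) refl (fromℕ M) α β (1/ℕ (k ^ r)) (fromℕ (k ^ n)) ⟩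
    fromℕ M * increment                  ≤⟨ ≤-trans (≤-reflexive (sym (+-identityˡ _))) (+-monoˡ-≤ (fromℕ M * increment) (totalEnergy-nonNeg I)) ⟩
    totalEnergy I + fromℕ M * increment  ∎
    where
    open ≤-Reasoning
    open +-*-Solver
    instance
      k^r≢0 = ℕ.m^n≢0 k r
      k^n≢0 = ℕ.m^n≢0 k n
    c = 1/ℕ (k ^ r) * fromℕ (k ^ n)
    c-pos : ℚ.Positive c
    c-pos = pos*pos⇒pos (1/ℕ (k ^ r)) {{1/ℕ-pos (k ^ r)}} (fromℕ (k ^ n)) {{fromℕ-pos (k ^ n)}}
    d*k^r*c≡ : fromℕ (d ℕ.* k ^ r) * c ≡ fromℕ d * fromℕ (k ^ n)
    d*k^r*c≡ = begin-equality
      fromℕ (d ℕ.* k ^ r) * c                                  ≡⟨ cong (_* c) (fromℕ-* d (k ^ r)) ⟩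
      fromℕ d * fromℕ (k ^ r) * (1/ℕ (k ^ r) * fromℕ (k ^ n))  ≡⟨ solve 4 (λ a b i p → a :* b :* (i :* p) := a :* p :* (b :* i)) refl (fromℕ d) (fromℕ (k ^ r)) (1/ℕ (k ^ r)) (fromℕ (k ^ n)) ⟩
      fromℕ d * fromℕ (k ^ n) * (fromℕ (k ^ r) * 1/ℕ (k ^ r))  ≡⟨ cong (fromℕ d * fromℕ (k ^ n) *_) (fromℕ*1/ℕ (k ^ r)) ⟩
      fromℕ d * fromℕ (k ^ n) * 1ℚ                             ≡⟨ *-identityʳ _ ⟩
      fromℕ d * fromℕ (k ^ n)                                  ∎

lemma3p3 : (k : ℕ) .{{_ : NonZero k}} (d r : ℕ) → 1 ℕ.≤ d → 1 ℕ.≤ r →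
  (β α : ℚ) → 0ℚ ℚ.< β → 0ℚ ℚ.< α →
  ∃ λ (C : ℕ) → (n : ℕ) → 1 ℕ.≤ n → (E : Fin d → Vec (Fin k) n → Bool) →
    Σ (Vec Bool n) λ I → (0 ℕ.< inCount I) × (inCount I ℕ.< C) ×
      ((j : Fin d) → probNotPR k r β (E j) I ℚ.≤ α)
lemma3p3 k d r _ _ β α 0<β 0<α = suc (iterate (grow k r) 1 M) , find
  where
  q = α * (β * β)
  0<q : 0ℚ < q
  0<q = positive⁻¹ q {{pos*pos⇒pos α {{ℚ.positive 0<α}} (β * β) {{pos*pos⇒pos β {{ℚ.positive 0<β}} β {{ℚ.positive 0<β}}}}}}
  fuel = archimedean q 0<q (d ℕ.* k ^ r)
  M = proj₁ fuel
  find : (n : ℕ) → 1 ℕ.≤ n → (E : Fin d → Vec (Fin k) n → Bool) →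
         Σ (Vec Bool n) λ I → (0 ℕ.< inCount I) × (inCount I ℕ.< suc (iterate (grow k r) 1 M)) × (∀ j → probNotPR k r β (E j) I ≤ α)
  find (suc n′) _ E =
    let I₀ = true ∷ replicate n′ false
        open Search k d r β α (<⇒≤ 0<β) E
        (I , 0<|I| , |I|≤ , good) = search M 1 I₀ (s≤s z≤n) (s≤s (ℕ.≤-reflexive (inCount-replicate-false n′)))
                                           (enoughFuel M (proj₂ fuel) I₀)
    in I , 0<|I| , s≤s |I|≤ , good
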